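{- Let $A$ carry an IF-structure in a strict symmetric monoidal $\dagger$-category, with antipode $s$. Let $f:A\to A$ be a bialgebra morphism for $(\delta_g,\epsilon_g,\mu_r,\eta_r)$. Then for all $g,h:A\to A$: (1) $f\circ(g+h)=(f\circ g)+(f\circ h)$; (2) $(g+h)\circ f=(g\circ f)+(h\circ f)$; (3) $f+(f\circ s)=0$.
   Context: Work in a strict symmetric monoidal $\dagger$-category (unit $I$, symmetry $\sigma$). A $\dagger$-SCFA on $A$ is $(\mu,\eta,\delta=\mu^\dagger,\epsilon=\eta^\dagger)$ with $(\mu,\eta)$ a commutative monoid, $(\mu\otimes\mathrm{id})(\mathrm{id}\otimes\delta)=\delta\mu=(\mathrm{id}\otimes\mu)(\delta\otimes\mathrm{id})$, and $\mu\delta=\mathrm{id}_A$. An IF-structure on $A$ is a pair of $\dagger$-SCFAs, green $(\mu_g,\eta_g,\delta_g,\epsilon_g)$ and red $(\mu_r,\eta_r,\delta_r,\epsilon_r)$, with $\delta_g\mu_r=(\mu_r\otimes\mu_r)(\mathrm{id}\otimes\sigma\otimes\mathrm{id})(\delta_g\otimes\delta_g)$, $\delta_g\eta_r=\eta_r\otimes\eta_r$, $\epsilon_g\mu_r=\epsilon_g\otimes\epsilon_g$ (scalar factors built from $\epsilon_g\eta_r$ suppressed throughout), $\eta_r=(\epsilon_r\otimes\mathrm{id}_A)\delta_g\eta_g$, $\epsilon_g=\epsilon_r\mu_r(\mathrm{id}_A\otimes\eta_g)$. The antipode is $s:=(\epsilon_g\mu_g\otimes\mathrm{id}_A)(\mathrm{id}_A\otimes\delta_r\eta_r)$.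 A bialgebra morphism for $(\delta_g,\epsilon_g,\mu_r,\eta_r)$ is $f:A\to A$ with $f\mu_r=\mu_r(f\otimes f)$, $f\eta_r=\eta_r$, $\delta_g f=(f\otimes f)\delta_g$, $\epsilon_g f=\epsilon_g$. Convolution: $g+h:=\mu_r\circ(g\otimes h)\circ\delta_g$ and $0:=\eta_r\circ\epsilon_g$. -}

module Defs where

open import Level using (Level; _⊔_; suc)
open import Relation.Binary.PropositionalEquality using (_≡_; refl; sym; subst)

-- Strictness: the
-- associativity and unit equations hold as equalities of objects, and the
-- associator / unitors are the transports of identities along them
-- (`coe`), which are required to be natural.  (K is available, so any two
-- such transports between the same objects coincide.)

record StrictSymMonDaggerCat (o ℓ : Level) : Set (suc (o ⊔ ℓ)) where
  infixr 9 _∘_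
  infixr 10 _⊗₁_
  infixr 10 _⊗₀_
  field
    Obj  : Set o
    Hom  : Obj → Obj → Set ℓ
    id   : ∀ {A} → Hom A A
    _∘_  : ∀ {A B C} → Hom B C → Hom A B → Hom A C
    identityˡ : ∀ {A B} (f : Hom A B) → id ∘ f ≡ f
    identityʳ : ∀ {A B} (f : Hom A B) → f ∘ id ≡ f
    assoc : ∀ {A B C D} (f : Hom C D) (g : Hom B C) (h : Hom A B) →
            (f ∘ g) ∘ h ≡ f ∘ (g ∘ h)

    _⊗₀_ : Obj → Obj → Obj
    I    : Obj
    _⊗₁_ : ∀ {A B C D} → Hom A B → Hom C D → Hom (A ⊗₀ C) (B ⊗₀ D)
    ⊗-id : ∀ {A B} → (id {A}) ⊗₁ (id {B}) ≡ id
    ⊗-∘  : ∀ {A B C D E F} (f : Hom B C) (g : Hom A B) (h : Hom E F) (k : Hom D E) →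
           (f ∘ g) ⊗₁ (h ∘ k) ≡ (f ⊗₁ h) ∘ (g ⊗₁ k)

    ⊗-assoc₀ : ∀ {A B C} → (A ⊗₀ B) ⊗₀ C ≡ A ⊗₀ (B ⊗₀ C)
    unitˡ₀   : ∀ {A} → I ⊗₀ A ≡ A
    unitʳ₀   : ∀ {A} → A ⊗₀ I ≡ A

  coe : ∀ {A B} → A ≡ B → Hom A B
  coe {A} p = subst (Hom A) p id

  α : ∀ {A B C} → Hom ((A ⊗₀ B) ⊗₀ C) (A ⊗₀ (B ⊗₀ C))
  α = coe ⊗-assoc₀
  α⁻¹ : ∀ {A B C} → Hom (A ⊗₀ (B ⊗₀ C)) ((A ⊗₀ B) ⊗₀ C)
  α⁻¹ = coe (sym ⊗-assoc₀)
  λ' : ∀ {A} → Hom (I ⊗₀ A) A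
  λ' = coe unitˡ₀
  λ⁻¹ : ∀ {A} → Hom A (I ⊗₀ A)
  λ⁻¹ = coe (sym unitˡ₀)
  ρ : ∀ {A} → Hom (A ⊗₀ I) A
  ρ = coe unitʳ₀
  ρ⁻¹ : ∀ {A} → Hom A (A ⊗₀ I)
  ρ⁻¹ = coe (sym unitʳ₀)

  field
    α-natural : ∀ {A B C D E F} (f : Hom A B) (g : Hom C D) (h : Hom E F) →
                α ∘ ((f ⊗₁ g) ⊗₁ h) ≡ (f ⊗₁ (g ⊗₁ h)) ∘ α
    λ-natural : ∀ {A B} (f : Hom A B) → λ' ∘ (id {I} ⊗₁ f) ≡ f ∘ λ'
    ρ-natural : ∀ {A B} (f : Hom A B) → ρ ∘ (f ⊗₁ id {I}) ≡ f ∘ ρ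

    σ : ∀ {A B} → Hom (A ⊗₀ B) (B ⊗₀ A)
    σ-natural : ∀ {A B C D} (f : Hom A B) (g : Hom C D) →
                σ ∘ (f ⊗₁ g) ≡ (g ⊗₁ f) ∘ σ
    σ-involutive : ∀ {A B} → σ {B} {A} ∘ σ {A} {B} ≡ id
    hexagon : ∀ {A B C} →
              α {B} {C} {A} ∘ σ {A} {B ⊗₀ C} ∘ α {A} {B} {C}
                ≡ (id {B} ⊗₁ σ {A} {C}) ∘ α {B} {A} {C} ∘ (σ {A} {B} ⊗₁ id {C})

    _† : ∀ {A B} → Hom A B → Hom B A
    †-involutive : ∀ {A B} (f : Hom A B) → (f †) † ≡ f
    †-id : ∀ {A} → (id {A}) † ≡ id
    †-∘  : ∀ {A B C} (f : Hom B C) (g : Hom A B) → (f ∘ g) † ≡ (g †) ∘ (f †)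
    †-⊗  : ∀ {A B C D} (f : Hom A B) (g : Hom C D) → (f ⊗₁ g) † ≡ (f †) ⊗₁ (g †)
    σ-†  : ∀ {A B} → (σ {A} {B}) † ≡ σ {B} {A}

  -- (A ⊗ B) ⊗ (C ⊗ D) → (A ⊗ C) ⊗ (B ⊗ D), i.e. id ⊗ σ ⊗ id
  middle-swap : ∀ {A B C D} → Hom ((A ⊗₀ B) ⊗₀ (C ⊗₀ D)) ((A ⊗₀ C) ⊗₀ (B ⊗₀ D))
  middle-swap = α⁻¹ ∘ (id ⊗₁ (α ∘ (σ ⊗₁ id) ∘ α⁻¹)) ∘ α

module _ {o ℓ} (𝒞 : StrictSymMonDaggerCat o ℓ) where
  open StrictSymMonDaggerCat 𝒞

  record DaggerSCFA (A : Obj) : Set ℓ where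
    field
      μ : Hom (A ⊗₀ A) A
      η : Hom I A
    δ : Hom A (A ⊗₀ A)
    δ = μ †
    ε : Hom A I
    ε = η †
    field
      μ-assoc : μ ∘ (μ ⊗₁ id) ≡ μ ∘ (id ⊗₁ μ) ∘ α
      μ-unitˡ : μ ∘ (η ⊗₁ id) ≡ λ'
      μ-unitʳ : μ ∘ (id ⊗₁ η) ≡ ρ
      μ-comm  : μ ∘ σ ≡ μ
      frobeniusˡ : (μ ⊗₁ id) ∘ α⁻¹ ∘ (id ⊗₁ δ) ≡ δ ∘ μ
      frobeniusʳ : (id ⊗₁ μ) ∘ α ∘ (δ ⊗₁ id) ≡ δ ∘ μ
      special : μ ∘ δ ≡ id

  -- IF-structure: green and red †-SCFAs satisfying the interaction laws
  -- (scalar factors ε_g η_r suppressed, i.e. laws stated exactly).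
  record IFStructure (A : Obj) : Set ℓ where
    field
      green : DaggerSCFA A
      red   : DaggerSCFA A
    open DaggerSCFA green public using ()
      renaming (μ to μg; η to ηg; δ to δg; ε to εg)
    open DaggerSCFA red public using ()
      renaming (μ to μr; η to ηr; δ to δr; ε to εr)
    field
      bialg-δμ : δg ∘ μr ≡ (μr ⊗₁ μr) ∘ middle-swap ∘ (δg ⊗₁ δg)
      bialg-δη : δg ∘ ηr ≡ (ηr ⊗₁ ηr) ∘ λ⁻¹
      bialg-εμ : εg ∘ μr ≡ λ' ∘ (εg ⊗₁ εg)
      ηr-def   : ηr ≡ λ' ∘ (εr ⊗₁ id) ∘ δg ∘ ηg
      εg-def   : εg ≡ εr ∘ μr ∘ (id ⊗₁ ηg) ∘ ρ⁻¹

    -- antipode s := (ε_g μ_g ⊗ id)(id ⊗ δ_r η_r)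
    antipode : Hom A A
    antipode = λ' ∘ ((εg ∘ μg) ⊗₁ id) ∘ α⁻¹ ∘ (id ⊗₁ (δr ∘ ηr)) ∘ ρ⁻¹

    _+_ : Hom A A → Hom A A → Hom A A
    g + h = μr ∘ (g ⊗₁ h) ∘ δg

    zero : Hom A A
    zero = ηr ∘ εg

    record IsBialgebraMorphism (f : Hom A A) : Set ℓ where
      field
        pres-μr : f ∘ μr ≡ μr ∘ (f ⊗₁ f)
        pres-ηr : f ∘ ηr ≡ ηr
        pres-δg : δg ∘ f ≡ (f ⊗₁ f) ∘ δg
        pres-εg : εg ∘ f ≡ εg

module Submission where

-- Additivity is immediate from f preserving μr, resp. δg.  The inverse
-- property reduces, via left additivity and f ∘ ηr = ηr, to the Hopf law
-- id + s = 0, which is the substance of the file.  Writing s as the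
-- transpose of the red cup along the green cap, and S for the mirror
-- transpose (red cap, green cup): the bialgebra law gives the Hopf law for S
-- directly; S is a comonoid morphism for δg; s and S are mutually inverse by
-- the snake equations; composing the Hopf law for S with s gives it for s.

open import Defs
open import Level using (_⊔_)
open import Relation.Binary.PropositionalEquality
open import Data.Product using (_×_; _,_)
open import Data.Nat using (ℕ) renaming (_+_ to _+ℕ_)
open import Data.Nat.Properties using (+-assoc; +-identityʳ)

-- Coherence for a strict symmetric monoidal †-category.
module Coherence {o ℓ} (𝒞 : StrictSymMonDaggerCat o ℓ) where
  open StrictSymMonDaggerCat 𝒞
  open ≡-Reasoning

  -- Since the
  -- structural isomorphisms are transports, every coherence question
  -- reduces to this relation.
  infix 4 _≅_
  record _≅_ {X Y Z W} (h : Hom X Y) (k : Hom Z W) : Set (o ⊔ ℓ) where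
    constructor ≅-intro
    field
      dom : X ≡ Z
      cod : Y ≡ W
      transported : subst₂ Hom dom cod h ≡ k

  ≡⇒≅ : ∀ {X Y} {h k : Hom X Y} → h ≡ k → h ≅ k
  ≡⇒≅ e = ≅-intro refl refl e

  ≅-refl : ∀ {X Y} {h : Hom X Y} → h ≅ h
  ≅-refl = ≡⇒≅ refl

  ≅-sym : ∀ {X Y Z W} {h : Hom X Y} {k : Hom Z W} → h ≅ k → k ≅ h
  ≅-sym (≅-intro refl refl e) = ≡⇒≅ (sym e)

  ≅-trans : ∀ {X Y Z W U V} {h : Hom X Y} {k : Hom Z W} {l : Hom U V} →
            h ≅ k → k ≅ l → h ≅ l
  ≅-trans (≅-intro refl refl e) (≅-intro refl refl e') = ≡⇒≅ (trans e e')

  -- Between parallel morphisms ≅ is equality (this uses axiom K).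
  ≅⇒≡ : ∀ {X Y} {h k : Hom X Y} → h ≅ k → h ≡ k
  ≅⇒≡ (≅-intro refl refl e) = e

  ≅-unique : ∀ {X Y Z W} {h h' : Hom X Y} {k : Hom Z W} → h ≅ k → h' ≅ k → h ≡ h'
  ≅-unique s t = ≅⇒≡ (≅-trans s (≅-sym t))

  ≅-∘ : ∀ {X Y Z X' Y' Z'} {h : Hom Y Z} {h' : Hom X Y} {k : Hom Y' Z'} {k' : Hom X' Y'} →
        h ≅ k → h' ≅ k' → h ∘ h' ≅ k ∘ k'
  ≅-∘ (≅-intro refl refl e) (≅-intro refl refl e') = ≡⇒≅ (cong₂ _∘_ e e')

  ≅-⊗ : ∀ {X Y Z W X' Y' Z' W'} {h : Hom X Y} {k : Hom Z W} {h' : Hom X' Y'} {k' : Hom Z' W'} →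
        h ≅ k → h' ≅ k' → h ⊗₁ h' ≅ k ⊗₁ k'
  ≅-⊗ (≅-intro refl refl e) (≅-intro refl refl e') = ≡⇒≅ (cong₂ _⊗₁_ e e')

  ≅-† : ∀ {X Y Z W} {h : Hom X Y} {k : Hom Z W} → h ≅ k → h † ≅ k †
  ≅-† (≅-intro refl refl e) = ≡⇒≅ (cong _† e)

  ≅-id : ∀ {X Z} → X ≡ Z → id {X} ≅ id {Z}
  ≅-id refl = ≅-refl

  ≅-coe : ∀ {X Y} (p : X ≡ Y) → coe p ≅ id {X}
  ≅-coe refl = ≅-refl

  absorbˡ : ∀ {X Y Y' Z W} {c : Hom Y Y'} {h : Hom X Y} {k : Hom Z W} →
            c ≅ id {Y} → h ≅ k → c ∘ h ≅ k
  absorbˡ (≅-intro refl refl e) (≅-intro refl refl e') =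
    ≡⇒≅ (trans (cong₂ _∘_ e e') (identityˡ _))

  absorbʳ : ∀ {X X' Y Z W} {c : Hom X' X} {h : Hom X Y} {k : Hom Z W} →
            h ≅ k → c ≅ id {X'} → h ∘ c ≅ k
  absorbʳ (≅-intro refl refl e') (≅-intro refl refl e) =
    ≡⇒≅ (trans (cong₂ _∘_ e' e) (identityʳ _))

  α≅id : ∀ {X Y Z} → α {X} {Y} {Z} ≅ id
  α≅id = ≅-coe ⊗-assoc₀

  α⁻¹≅id : ∀ {X Y Z} → α⁻¹ {X} {Y} {Z} ≅ id
  α⁻¹≅id = ≅-coe (sym ⊗-assoc₀)

  λ≅id : ∀ {X} → λ' {X} ≅ id
  λ≅id = ≅-coe unitˡ₀

  λ⁻¹≅id : ∀ {X} → λ⁻¹ {X} ≅ id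
  λ⁻¹≅id = ≅-coe (sym unitˡ₀)

  ρ≅id : ∀ {X} → ρ {X} ≅ id
  ρ≅id = ≅-coe unitʳ₀

  ρ⁻¹≅id : ∀ {X} → ρ⁻¹ {X} ≅ id
  ρ⁻¹≅id = ≅-coe (sym unitʳ₀)

  -- Strictness: the tensor is associative and unital up to ≅, by naturality
  -- of the structural maps.
  ≅-assoc : ∀ {X Y Z X' Y' Z'} (f : Hom X X') (g : Hom Y Y') (h : Hom Z Z') →
            f ⊗₁ (g ⊗₁ h) ≅ (f ⊗₁ g) ⊗₁ h
  ≅-assoc f g h = ≅-sym (≅-trans (≅-sym (absorbˡ α≅id ≅-refl))
                        (≅-trans (≡⇒≅ (α-natural f g h)) (absorbʳ ≅-refl α≅id)))

  ≅-unitˡ : ∀ {X Y} (f : Hom X Y) → id {I} ⊗₁ f ≅ f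
  ≅-unitˡ f = ≅-trans (≅-sym (absorbˡ λ≅id ≅-refl))
                      (≅-trans (≡⇒≅ (λ-natural f)) (absorbʳ ≅-refl λ≅id))

  ≅-unitʳ : ∀ {X Y} (f : Hom X Y) → f ⊗₁ id {I} ≅ f
  ≅-unitʳ f = ≅-trans (≅-sym (absorbˡ ρ≅id ≅-refl))
                      (≅-trans (≡⇒≅ (ρ-natural f)) (absorbʳ ≅-refl ρ≅id))

  ≅-id⊗ : ∀ {X Y Y'} {c : Hom Y Y'} → c ≅ id {Y} → id {X} ⊗₁ c ≅ id {X ⊗₀ Y}
  ≅-id⊗ c≅id = ≅-trans (≅-⊗ ≅-refl c≅id) (≡⇒≅ ⊗-id)

  ≅-⊗id : ∀ {X Y Y'} {c : Hom Y Y'} → c ≅ id {Y} → c ⊗₁ id {X} ≅ id {Y ⊗₀ X}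
  ≅-⊗id c≅id = ≅-trans (≅-⊗ c≅id ≅-refl) (≡⇒≅ ⊗-id)

  idempotent-retraction : ∀ {X} {x : Hom X X} (y : Hom X X) →
                          y ∘ x ≡ id → x ∘ x ≡ x → x ≡ id
  idempotent-retraction {x = x} y yx≡id xx≡x = begin
    x             ≡⟨ sym (identityˡ x) ⟩
    id ∘ x        ≡⟨ cong (_∘ x) (sym yx≡id) ⟩
    (y ∘ x) ∘ x   ≡⟨ assoc y x x ⟩
    y ∘ (x ∘ x)   ≡⟨ cong (y ∘_) xx≡x ⟩
    y ∘ x         ≡⟨ yx≡id ⟩
    id            ∎

  -- The symmetry σ : X ⊗ I → I ⊗ X is the identity up to ≅.  Its
  -- strictification x : X → X is idempotent by the hexagon at (X, I, I),
  -- and has a left inverse because σ is involutive.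
  σ-unit : ∀ {X} → λ' ∘ σ {X} {I} ≡ ρ
  σ-unit {X} = ≅-unique (≅-trans (absorbˡ λ≅id ≅-refl) (≅-trans σ≅x (≡⇒≅ x≡id)))
                        (≅-trans ρ≅id (≅-id unitʳ₀))
    where
    x : Hom X X
    x = λ' ∘ σ {X} {I} ∘ ρ⁻¹

    σ≅x : σ {X} {I} ≅ x
    σ≅x = ≅-sym (absorbˡ λ≅id (absorbʳ ≅-refl ρ⁻¹≅id))

    y : Hom X X
    y = ρ ∘ σ {I} {X} ∘ λ⁻¹

    y∘x≡id : y ∘ x ≡ id
    y∘x≡id = ≅⇒≡ (≅-trans (≅-∘ (absorbˡ ρ≅id (absorbʳ ≅-refl λ⁻¹≅id)) (≅-sym σ≅x))
                          (≅-trans (≡⇒≅ σ-involutive) (≅-id unitʳ₀)))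

    -- σ {X} {I ⊗ I} agrees with σ {X} {I}, by naturality along λ' {I}.
    σ-I⊗I : σ {X} {I ⊗₀ I} ≅ σ {X} {I}
    σ-I⊗I = ≅-trans (≅-sym (absorbˡ (≅-⊗id λ≅id) ≅-refl))
                    (≅-trans (≡⇒≅ (sym (σ-natural id λ'))) (absorbʳ ≅-refl (≅-id⊗ λ≅id)))

    hexagon-lhs : α {I} {I} {X} ∘ σ {X} {I ⊗₀ I} ∘ α {X} {I} {I} ≅ x
    hexagon-lhs = absorbˡ α≅id (absorbʳ (≅-trans σ-I⊗I σ≅x) α≅id)

    hexagon-rhs : (id {I} ⊗₁ σ {X} {I}) ∘ α {I} {X} {I} ∘ (σ {X} {I} ⊗₁ id {I}) ≅ x ∘ x
    hexagon-rhs = ≅-∘ (≅-trans (≅-unitˡ σ) σ≅x) (absorbˡ α≅id (≅-trans (≅-unitʳ σ) σ≅x))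

    x∘x≡x : x ∘ x ≡ x
    x∘x≡x = ≅⇒≡ (≅-trans (≅-sym hexagon-rhs) (≅-trans (≡⇒≅ (sym hexagon)) hexagon-lhs))

    x≡id : x ≡ id
    x≡id = idempotent-retraction y y∘x≡id x∘x≡x

  σ≅id : ∀ {X} → σ {X} {I} ≅ id {X ⊗₀ I}
  σ≅id = ≅-trans (≅-sym (absorbˡ λ≅id ≅-refl)) (≅-trans (≡⇒≅ σ-unit) ρ≅id)

  hexagon′ : ∀ {X Y Z} → (α⁻¹ ∘ (id ⊗₁ σ {X} {Z}) ∘ α) ∘ (σ {X} {Y} ⊗₁ id) ≡ σ {X} {Y ⊗₀ Z} ∘ α
  hexagon′ = ≅⇒≡ (≅-trans (≡⇒≅ (trans (assoc _ _ _) (cong (α⁻¹ ∘_) (assoc _ _ _))))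
                 (≅-trans (absorbˡ α⁻¹≅id (≡⇒≅ (sym hexagon))) (absorbˡ α≅id ≅-refl)))

-- Indexing by
-- natural numbers makes the tensor of such morphisms strictly typed, so that
-- string-diagram calculations can be carried out as equations.
module TensorPowers {o ℓ} (𝒞 : StrictSymMonDaggerCat o ℓ) (A : StrictSymMonDaggerCat.Obj 𝒞) where
  open StrictSymMonDaggerCat 𝒞
  open Coherence 𝒞
  open ≡-Reasoning

  -- A^⊗n, bracketed to the right
  pow : ℕ → Obj
  pow 0 = I
  pow 1 = A
  pow (ℕ.suc (ℕ.suc n)) = A ⊗₀ pow (ℕ.suc n)

  split : ∀ m n → pow (m +ℕ n) ≡ pow m ⊗₀ pow n
  split 0 n = sym unitˡ₀
  split 1 0 = sym unitʳ₀
  split 1 (ℕ.suc n) = refl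
  split (ℕ.suc (ℕ.suc m)) n = trans (cong (A ⊗₀_) (split (ℕ.suc m) n)) (sym ⊗-assoc₀)

  record Mor (m n : ℕ) : Set ℓ where
    constructor mk
    field un : Hom (pow m) (pow n)
  open Mor public

  idM : ∀ {m} → Mor m m
  idM = mk id

  σM : Mor 2 2
  σM = mk σ

  id₀ : Mor 0 0
  id₀ = idM
  id₁ : Mor 1 1
  id₁ = idM
  id₂ : Mor 2 2
  id₂ = idM
  id₃ : Mor 3 3
  id₃ = idM

  _†M : ∀ {m n} → Mor m n → Mor n m
  f †M = mk (un f †)

  reindex : ∀ {m m' n n'} → m ≡ m' → n ≡ n' → Mor m n → Mor m' n'
  reindex refl refl f = f

  un-reindex : ∀ {m m' n n'} (p : m ≡ m') (q : n ≡ n') (f : Mor m n) → un (reindex p q f) ≅ un f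
  un-reindex refl refl f = ≅-refl

  Mor-≅ : ∀ {m n Z W} {f g : Mor m n} {k : Hom Z W} → un f ≅ k → un g ≅ k → f ≡ g
  Mor-≅ s t = cong mk (≅-unique s t)

  infixr 9 _∙_
  infixr 10 _⊠_
  opaque
    _∙_ : ∀ {m n p} → Mor n p → Mor m n → Mor m p
    f ∙ g = mk (un f ∘ un g)

    _⊠_ : ∀ {m m' n n'} → Mor m m' → Mor n n' → Mor (m +ℕ n) (m' +ℕ n')
    _⊠_ {m} {m'} {n} {n'} f g = mk (coe (sym (split m' n')) ∘ (un f ⊗₁ un g) ∘ coe (split m n))

    un-∙ : ∀ {m n p} (f : Mor n p) (g : Mor m n) → un (f ∙ g) ≡ un f ∘ un g
    un-∙ f g = refl

    un-⊠ : ∀ {m m' n n'} (f : Mor m m') (g : Mor n n') → un (f ⊠ g) ≅ un f ⊗₁ un g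
    un-⊠ {m} {m'} {n} {n'} f g = absorbˡ (≅-coe (sym (split m' n'))) (absorbʳ ≅-refl (≅-coe (split m n)))

  ≅-∙ : ∀ {m n p X Y Z} {f : Mor n p} {g : Mor m n} {h : Hom Y Z} {k : Hom X Y} →
        un f ≅ h → un g ≅ k → un (f ∙ g) ≅ h ∘ k
  ≅-∙ {f = f} {g} s t = ≅-trans (≡⇒≅ (un-∙ f g)) (≅-∘ s t)

  ≅-⊠ : ∀ {m m' n n' X Y Z W} {f : Mor m m'} {g : Mor n n'} {h : Hom X Y} {k : Hom Z W} →
        un f ≅ h → un g ≅ k → un (f ⊠ g) ≅ h ⊗₁ k
  ≅-⊠ {f = f} {g} s t = ≅-trans (un-⊠ f g) (≅-⊗ s t)

  ∙-assoc : ∀ {m n p q} (f : Mor p q) (g : Mor n p) (h : Mor m n) → (f ∙ g) ∙ h ≡ f ∙ (g ∙ h)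
  ∙-assoc f g h = Mor-≅ (≅-∙ (≅-∙ ≅-refl ≅-refl) ≅-refl)
                        (≅-trans (≅-∙ ≅-refl (≅-∙ ≅-refl ≅-refl)) (≡⇒≅ (sym (assoc _ _ _))))

  ∙-idl : ∀ {m n} (f : Mor m n) → idM ∙ f ≡ f
  ∙-idl f = Mor-≅ (≅-trans (≅-∙ ≅-refl ≅-refl) (≡⇒≅ (identityˡ _))) ≅-refl

  ∙-idr : ∀ {m n} (f : Mor m n) → f ∙ idM ≡ f
  ∙-idr f = Mor-≅ (≅-trans (≅-∙ ≅-refl ≅-refl) (≡⇒≅ (identityʳ _))) ≅-refl

  ⊠-∙ : ∀ {m m' n n' k l} (f : Mor m m') (g : Mor n n') (f' : Mor k m) (g' : Mor l n) →
        (f ⊠ g) ∙ (f' ⊠ g') ≡ (f ∙ f') ⊠ (g ∙ g')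
  ⊠-∙ f g f' g' = Mor-≅ (≅-trans (≅-∙ (un-⊠ f g) (un-⊠ f' g')) (≡⇒≅ (sym (⊗-∘ _ _ _ _))))
                        (≅-⊠ (≅-∙ ≅-refl ≅-refl) (≅-∙ ≅-refl ≅-refl))

  ⊠-id : ∀ {m n} → idM {m} ⊠ idM {n} ≡ idM
  ⊠-id {m} {n} = Mor-≅ (≅-trans (un-⊠ idM idM) (≡⇒≅ ⊗-id)) (≅-id (split m n))

  ⊠-assoc : ∀ {m m' n n' p p'} (f : Mor m m') (g : Mor n n') (h : Mor p p') →
            reindex (+-assoc m n p) (+-assoc m' n' p') ((f ⊠ g) ⊠ h) ≡ f ⊠ (g ⊠ h)
  ⊠-assoc f g h =
    Mor-≅ (≅-trans (un-reindex _ _ _) (≅-⊠ (un-⊠ f g) ≅-refl))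
          (≅-trans (≅-⊠ ≅-refl (un-⊠ g h)) (≅-assoc _ _ _))

  ⊠-unitˡ : ∀ {m m'} (f : Mor m m') → idM {0} ⊠ f ≡ f
  ⊠-unitˡ f = Mor-≅ (≅-trans (un-⊠ idM f) (≅-unitˡ _)) ≅-refl

  ⊠-unitʳ : ∀ {m m'} (f : Mor m m') → reindex (+-identityʳ m) (+-identityʳ m') (f ⊠ idM {0}) ≡ f
  ⊠-unitʳ f = Mor-≅ (≅-trans (un-reindex _ _ _) (≅-trans (un-⊠ f idM) (≅-unitʳ _))) ≅-refl

  †-∙ : ∀ {m n p} (f : Mor n p) (g : Mor m n) → (f ∙ g) †M ≡ (g †M) ∙ (f †M)
  †-∙ f g = Mor-≅ (≅-trans (≅-† (≅-∙ ≅-refl ≅-refl)) (≡⇒≅ (†-∘ _ _))) (≅-∙ ≅-refl ≅-refl)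

  †-⊠ : ∀ {m m' n n'} (f : Mor m m') (g : Mor n n') → (f ⊠ g) †M ≡ (f †M) ⊠ (g †M)
  †-⊠ f g = Mor-≅ (≅-trans (≅-† (un-⊠ f g)) (≡⇒≅ (†-⊗ _ _))) (un-⊠ (f †M) (g †M))

  †-involutiveM : ∀ {m n} (f : Mor m n) → (f †M) †M ≡ f
  †-involutiveM f = cong mk (†-involutive _)

  †-idM : ∀ {m} → idM {m} †M ≡ idM
  †-idM = cong mk †-id

  σ†M : σM †M ≡ σM
  σ†M = cong mk σ-†

  σ-naturalM : (f g : Mor 1 1) → σM ∙ (f ⊠ g) ≡ (g ⊠ f) ∙ σM
  σ-naturalM f g = Mor-≅ (≅-trans (≅-∙ ≅-refl (un-⊠ f g)) (≡⇒≅ (σ-natural _ _)))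
                         (≅-∙ (un-⊠ g f) ≅-refl)

  -- A "cap" g on the first two of three wires, after rotating the wires,
  -- is the cap on the last two (a consequence of the hexagon and σ-unit).
  cap-rotate : (g : Mor 2 0) → (g ⊠ id₁) ∙ (id₁ ⊠ σM) ∙ (σM ⊠ id₁) ≡ id₁ ⊠ g
  cap-rotate g = Mor-≅ lhs≅ (un-⊠ idM g)
    where
    G = un g
    middle≅ : un (id₁ ⊠ σM) ≅ α⁻¹ ∘ (id {A} ⊗₁ σ {A} {A}) ∘ α
    middle≅ = ≅-trans (un-⊠ idM σM) (≅-sym (absorbˡ α⁻¹≅id (absorbʳ ≅-refl α≅id)))
    lhs≅ : un ((g ⊠ id₁) ∙ (id₁ ⊠ σM) ∙ (σM ⊠ id₁)) ≅ id {A} ⊗₁ G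
    lhs≅ = ≅-trans (≅-∙ (un-⊠ g idM) (≅-∙ middle≅ (un-⊠ σM idM))) (≅-trans (≡⇒≅ (begin
        (G ⊗₁ id) ∘ (α⁻¹ ∘ (id ⊗₁ σ) ∘ α) ∘ (σ ⊗₁ id) ≡⟨ cong ((G ⊗₁ id) ∘_) hexagon′ ⟩
        (G ⊗₁ id) ∘ σ ∘ α                            ≡⟨ sym (assoc _ _ _) ⟩
        ((G ⊗₁ id) ∘ σ) ∘ α                          ≡⟨ cong (_∘ α) (sym (σ-natural id G)) ⟩
        (σ ∘ (id ⊗₁ G)) ∘ α                          ≡⟨ assoc _ _ _ ⟩
        σ ∘ (id ⊗₁ G) ∘ α                            ∎))
      (absorbˡ σ≅id (absorbʳ ≅-refl α≅id)))

  infixl 5 _⟨∙_ _∙⟩_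
  _⟨∙_ : ∀ {m n p} {f f' : Mor n p} → f ≡ f' → (g : Mor m n) → f ∙ g ≡ f' ∙ g
  e ⟨∙ g = cong (_∙ g) e
  _∙⟩_ : ∀ {m n p} (f : Mor n p) {g g' : Mor m n} → g ≡ g' → f ∙ g ≡ f ∙ g'
  f ∙⟩ e = cong (f ∙_) e

  ⊠≡ : ∀ {m m' n n'} {f f' : Mor m m'} {g g' : Mor n n'} → f ≡ f' → g ≡ g' → f ⊠ g ≡ f' ⊠ g'
  ⊠≡ = cong₂ _⊠_

  ∙-⊠ : ∀ {m m' n n' k l} (f : Mor m m') (g : Mor n n') (f' : Mor k m) (g' : Mor l n) →
        (f ∙ f') ⊠ (g ∙ g') ≡ (f ⊠ g) ∙ (f' ⊠ g')
  ∙-⊠ f g f' g' = sym (⊠-∙ f g f' g')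

  state⊠effect : (p : Mor 0 1) (q : Mor 1 0) → p ⊠ q ≡ p ∙ q
  state⊠effect p q = begin
    p ⊠ q                 ≡⟨ ⊠≡ (sym (∙-idr p)) (sym (∙-idl q)) ⟩
    (p ∙ id₀) ⊠ (id₀ ∙ q) ≡⟨ ∙-⊠ p id₀ id₀ q ⟩
    (p ⊠ id₀) ∙ (id₀ ⊠ q) ≡⟨ cong₂ _∙_ (⊠-unitʳ p) (⊠-unitˡ q) ⟩
    p ∙ q                 ∎

  effect⊠state : (q : Mor 1 0) (p : Mor 0 1) → q ⊠ p ≡ p ∙ q
  effect⊠state q p = begin
    q ⊠ p                 ≡⟨ ⊠≡ (sym (∙-idl q)) (sym (∙-idr p)) ⟩
    (id₀ ∙ q) ⊠ (p ∙ id₀) ≡⟨ ∙-⊠ id₀ p q id₀ ⟩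
    (id₀ ⊠ p) ∙ (q ⊠ id₀) ≡⟨ cong₂ _∙_ (⊠-unitˡ p) (⊠-unitʳ q) ⟩
    p ∙ q                 ∎

  -- Placing a state X to the right of a map f with two outputs.
  -- (For n = 0, 1 the reindexing is the identity.)
  state-right : ∀ {n k} (f : Mor n 2) (X : Mor 0 k) →
                (id₁ ⊠ (id₁ ⊠ X)) ∙ f ≡ reindex (+-identityʳ n) refl (f ⊠ X)
  state-right f X = Mor-≅ lhs≅ (≅-trans (un-reindex _ _ _) (un-⊠ f X))
    where
    F = un f
    lhs≅ : un ((id₁ ⊠ (id₁ ⊠ X)) ∙ f) ≅ F ⊗₁ un X
    lhs≅ = ≅-trans (≅-∙ (≅-trans (≅-⊠ ≅-refl (un-⊠ id₁ X)) (≅-assoc id id (un X)))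
                        (≅-sym (≅-unitʳ F)))
                   (≡⇒≅ (begin
                     ((id ⊗₁ id) ⊗₁ un X) ∘ (F ⊗₁ id) ≡⟨ sym (⊗-∘ _ _ _ _) ⟩
                     ((id ⊗₁ id) ∘ F) ⊗₁ (un X ∘ id)  ≡⟨ cong₂ _⊗₁_ (trans (cong (_∘ F) ⊗-id) (identityˡ F)) (identityʳ _) ⟩
                     F ⊗₁ un X                       ∎))

  transpose : Mor 2 0 → Mor 0 2 → Mor 1 1
  transpose q X = (q ⊠ id₁) ∙ (id₁ ⊠ X)

  transpose-slide : (q : Mor 2 0) (X Y : Mor 0 2) → (id₁ ⊠ q) ∙ (Y ⊠ id₁) ≡ id₁ →
                    (id₁ ⊠ transpose q X) ∙ Y ≡ X
  transpose-slide q X Y snake = begin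
    (id₁ ⊠ ((q ⊠ id₁) ∙ (id₁ ⊠ X))) ∙ Y
      ≡⟨ trans (⊠≡ (sym (∙-idl id₁)) refl) (∙-⊠ id₁ (q ⊠ id₁) id₁ (id₁ ⊠ X)) ⟨∙ Y ⟩
    ((id₁ ⊠ (q ⊠ id₁)) ∙ (id₁ ⊠ (id₁ ⊠ X))) ∙ Y ≡⟨ ∙-assoc _ _ _ ⟩
    (id₁ ⊠ (q ⊠ id₁)) ∙ (id₁ ⊠ (id₁ ⊠ X)) ∙ Y   ≡⟨ cong₂ _∙_ (sym (⊠-assoc id₁ q id₁)) (state-right Y X) ⟩
    ((id₁ ⊠ q) ⊠ id₁) ∙ (Y ⊠ X)                ≡⟨ ((id₁ ⊠ q) ⊠ id₁) ∙⟩ Y⊠X ⟩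
    ((id₁ ⊠ q) ⊠ id₁) ∙ ((Y ⊠ id₁) ⊠ id₁) ∙ X  ≡⟨ sym (∙-assoc _ _ _) ⟩
    (((id₁ ⊠ q) ⊠ id₁) ∙ ((Y ⊠ id₁) ⊠ id₁)) ∙ X
      ≡⟨ trans (⊠-∙ (id₁ ⊠ q) id₁ (Y ⊠ id₁) id₁) (trans (⊠≡ snake (∙-idl id₁)) ⊠-id) ⟨∙ X ⟩
    id₂ ∙ X                                    ≡⟨ ∙-idl X ⟩
    X                                          ∎
    where
    Y⊠X : Y ⊠ X ≡ ((Y ⊠ id₁) ⊠ id₁) ∙ X
    Y⊠X = begin
      Y ⊠ X                 ≡⟨ ⊠≡ (sym (∙-idr Y)) (sym (∙-idl X)) ⟩
      (Y ∙ id₀) ⊠ (id₂ ∙ X) ≡⟨ ∙-⊠ Y id₂ id₀ X ⟩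
      (Y ⊠ id₂) ∙ (id₀ ⊠ X) ≡⟨ cong₂ _∙_ (trans (⊠≡ refl (sym ⊠-id)) (sym (⊠-assoc Y id₁ id₁))) (⊠-unitˡ X) ⟩
      ((Y ⊠ id₁) ⊠ id₁) ∙ X ∎

  transpose-absorb : (q : Mor 2 0) (t : Mor 1 1) (X Y : Mor 0 2) → (id₁ ⊠ t) ∙ X ≡ Y →
                     t ∙ transpose q X ≡ transpose q Y
  transpose-absorb q t X Y tX≡Y = begin
    t ∙ (q ⊠ id₁) ∙ (id₁ ⊠ X)             ≡⟨ sym (∙-assoc _ _ _) ⟩
    (t ∙ (q ⊠ id₁)) ∙ (id₁ ⊠ X)           ≡⟨ t-past-q ⟨∙ (id₁ ⊠ X) ⟩
    ((q ⊠ id₁) ∙ (id₂ ⊠ t)) ∙ (id₁ ⊠ X)   ≡⟨ ∙-assoc _ _ _ ⟩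
    (q ⊠ id₁) ∙ (id₂ ⊠ t) ∙ (id₁ ⊠ X)     ≡⟨ (q ⊠ id₁) ∙⟩ t-onto-X ⟩
    (q ⊠ id₁) ∙ (id₁ ⊠ Y)                 ∎
    where
    t-past-q : t ∙ (q ⊠ id₁) ≡ (q ⊠ id₁) ∙ (id₂ ⊠ t)
    t-past-q = begin
      t ∙ (q ⊠ id₁)          ≡⟨ sym (⊠-unitˡ t) ⟨∙ (q ⊠ id₁) ⟩
      (id₀ ⊠ t) ∙ (q ⊠ id₁)  ≡⟨ ⊠-∙ id₀ t q id₁ ⟩
      (id₀ ∙ q) ⊠ (t ∙ id₁)  ≡⟨ ⊠≡ (trans (∙-idl q) (sym (∙-idr q))) (trans (∙-idr t) (sym (∙-idl t))) ⟩
      (q ∙ id₂) ⊠ (id₁ ∙ t)  ≡⟨ ∙-⊠ q id₁ id₂ t ⟩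
      (q ⊠ id₁) ∙ (id₂ ⊠ t)  ∎
    t-onto-X : (id₂ ⊠ t) ∙ (id₁ ⊠ X) ≡ id₁ ⊠ Y
    t-onto-X = begin
      (id₂ ⊠ t) ∙ (id₁ ⊠ X)          ≡⟨ trans (⊠≡ (sym ⊠-id) refl) (⊠-assoc id₁ id₁ t) ⟨∙ (id₁ ⊠ X) ⟩
      (id₁ ⊠ (id₁ ⊠ t)) ∙ (id₁ ⊠ X)  ≡⟨ ⊠-∙ id₁ (id₁ ⊠ t) id₁ X ⟩
      (id₁ ∙ id₁) ⊠ ((id₁ ⊠ t) ∙ X)  ≡⟨ ⊠≡ (∙-idl id₁) tX≡Y ⟩
      id₁ ⊠ Y                        ∎

  middle-swapM : Mor 4 4
  middle-swapM = id₁ ⊠ (σM ⊠ id₁)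

  cap-slide : (g : Mor 2 0) (h : Mor 2 1) →
              (g ⊠ h) ∙ middle-swapM ∙ (σM ⊠ id₂) ≡ h ∙ (id₁ ⊠ (g ⊠ id₁))
  cap-slide g h = begin
    (g ⊠ h) ∙ middle-swapM ∙ (σM ⊠ id₂)
      ≡⟨ trans (⊠≡ (sym (∙-idl g)) (sym (∙-idr h))) (∙-⊠ id₀ h g id₂) ⟨∙ _ ⟩
    ((id₀ ⊠ h) ∙ (g ⊠ id₂)) ∙ middle-swapM ∙ (σM ⊠ id₂) ≡⟨ ∙-assoc _ _ _ ⟩
    (id₀ ⊠ h) ∙ (g ⊠ id₂) ∙ middle-swapM ∙ (σM ⊠ id₂)   ≡⟨ cong₂ _∙_ (⊠-unitˡ h) rotate ⟩
    h ∙ (id₁ ⊠ (g ⊠ id₁))                              ∎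
    where
    rotate : (g ⊠ id₂) ∙ middle-swapM ∙ (σM ⊠ id₂) ≡ id₁ ⊠ (g ⊠ id₁)
    rotate = begin
      (g ⊠ id₂) ∙ (id₁ ⊠ (σM ⊠ id₁)) ∙ (σM ⊠ id₂)
        ≡⟨ cong₂ _∙_ (trans (⊠≡ refl (sym ⊠-id)) (sym (⊠-assoc g id₁ id₁)))
                     (cong₂ _∙_ (sym (⊠-assoc id₁ σM id₁)) (trans (⊠≡ refl (sym ⊠-id)) (sym (⊠-assoc σM id₁ id₁)))) ⟩
      ((g ⊠ id₁) ⊠ id₁) ∙ ((id₁ ⊠ σM) ⊠ id₁) ∙ ((σM ⊠ id₁) ⊠ id₁)
        ≡⟨ ((g ⊠ id₁) ⊠ id₁) ∙⟩ ⊠-∙ (id₁ ⊠ σM) id₁ (σM ⊠ id₁) id₁ ⟩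
      ((g ⊠ id₁) ⊠ id₁) ∙ (((id₁ ⊠ σM) ∙ (σM ⊠ id₁)) ⊠ (id₁ ∙ id₁))
        ≡⟨ ⊠-∙ (g ⊠ id₁) id₁ ((id₁ ⊠ σM) ∙ (σM ⊠ id₁)) (id₁ ∙ id₁) ⟩
      ((g ⊠ id₁) ∙ (id₁ ⊠ σM) ∙ (σM ⊠ id₁)) ⊠ (id₁ ∙ id₁ ∙ id₁)
        ≡⟨ ⊠≡ (cap-rotate g) (trans (∙-idl _) (∙-idl _)) ⟩
      (id₁ ⊠ g) ⊠ id₁ ≡⟨ ⊠-assoc id₁ g id₁ ⟩
      id₁ ⊠ (g ⊠ id₁) ∎

module FrobeniusLaws {o ℓ} (𝒞 : StrictSymMonDaggerCat o ℓ) {A : StrictSymMonDaggerCat.Obj 𝒞}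
                     (F : DaggerSCFA 𝒞 A) where
  open StrictSymMonDaggerCat 𝒞
  open Coherence 𝒞
  open TensorPowers 𝒞 A
  open DaggerSCFA F
  open ≡-Reasoning

  m : Mor 2 1
  m = mk μ
  u : Mor 0 1
  u = mk η
  d : Mor 1 2
  d = mk δ
  e : Mor 1 0
  e = mk ε

  μ-assocM : m ∙ (m ⊠ id₁) ≡ m ∙ (id₁ ⊠ m)
  μ-assocM = Mor-≅ (≅-trans (≅-∙ ≅-refl (un-⊠ m id₁))
                            (≅-trans (≡⇒≅ μ-assoc) (≅-∘ ≅-refl (absorbʳ ≅-refl α≅id))))
                   (≅-∙ ≅-refl (un-⊠ id₁ m))

  μ-unitˡM : m ∙ (u ⊠ id₁) ≡ id₁
  μ-unitˡM = Mor-≅ (≅-trans (≅-∙ ≅-refl (un-⊠ u id₁)) (≅-trans (≡⇒≅ μ-unitˡ) λ≅id))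
                   (≅-id (sym unitˡ₀))

  μ-unitʳM : m ∙ (id₁ ⊠ u) ≡ id₁
  μ-unitʳM = Mor-≅ (≅-trans (≅-∙ ≅-refl (un-⊠ id₁ u)) (≅-trans (≡⇒≅ μ-unitʳ) ρ≅id))
                   (≅-id (sym unitʳ₀))

  μ-commM : m ∙ σM ≡ m
  μ-commM = Mor-≅ (≅-trans (≅-∙ ≅-refl ≅-refl) (≡⇒≅ μ-comm)) ≅-refl

  frobeniusˡM : (m ⊠ id₁) ∙ (id₁ ⊠ d) ≡ d ∙ m
  frobeniusˡM = Mor-≅ (≅-trans (≅-∙ (≅-trans (un-⊠ m id₁) (≅-sym (absorbʳ ≅-refl α⁻¹≅id))) (un-⊠ id₁ d))
                              (≡⇒≅ (trans (assoc _ _ _) frobeniusˡ)))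
                      (≅-∙ ≅-refl ≅-refl)

  frobeniusʳM : (id₁ ⊠ m) ∙ (d ⊠ id₁) ≡ d ∙ m
  frobeniusʳM = Mor-≅ (≅-trans (≅-∙ (un-⊠ id₁ m) (≅-trans (un-⊠ d id₁) (≅-sym (absorbˡ α≅id ≅-refl))))
                              (≡⇒≅ frobeniusʳ))
                      (≅-∙ ≅-refl ≅-refl)

  -- The comonoid laws of (δ, ε), as daggers of the monoid laws.
  δ-coassocM : (d ⊠ id₁) ∙ d ≡ (id₁ ⊠ d) ∙ d
  δ-coassocM = begin
    (d ⊠ id₁) ∙ d            ≡⟨ cong (λ z → (d ⊠ z) ∙ d) (sym †-idM) ⟩
    (d ⊠ (id₁ †M)) ∙ d       ≡⟨ sym (†-⊠ m id₁) ⟨∙ d ⟩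
    ((m ⊠ id₁) †M) ∙ (m †M)  ≡⟨ sym (†-∙ m (m ⊠ id₁)) ⟩
    (m ∙ (m ⊠ id₁)) †M       ≡⟨ cong _†M μ-assocM ⟩
    (m ∙ (id₁ ⊠ m)) †M       ≡⟨ †-∙ m (id₁ ⊠ m) ⟩
    ((id₁ ⊠ m) †M) ∙ d       ≡⟨ †-⊠ id₁ m ⟨∙ d ⟩
    ((id₁ †M) ⊠ d) ∙ d       ≡⟨ cong (λ z → (z ⊠ d) ∙ d) †-idM ⟩
    (id₁ ⊠ d) ∙ d            ∎

  δ-counitˡM : (e ⊠ id₁) ∙ d ≡ id₁
  δ-counitˡM = begin
    (e ⊠ id₁) ∙ d            ≡⟨ cong (λ z → (e ⊠ z) ∙ d) (sym †-idM) ⟩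
    (e ⊠ (id₁ †M)) ∙ d       ≡⟨ sym (†-⊠ u id₁) ⟨∙ d ⟩
    ((u ⊠ id₁) †M) ∙ (m †M)  ≡⟨ sym (†-∙ m (u ⊠ id₁)) ⟩
    (m ∙ (u ⊠ id₁)) †M       ≡⟨ cong _†M μ-unitˡM ⟩
    id₁ †M                   ≡⟨ †-idM ⟩
    id₁                      ∎

  δ-counitʳM : (id₁ ⊠ e) ∙ d ≡ id₁
  δ-counitʳM = begin
    (id₁ ⊠ e) ∙ d            ≡⟨ cong (λ z → (z ⊠ e) ∙ d) (sym †-idM) ⟩
    ((id₁ †M) ⊠ e) ∙ d       ≡⟨ sym (†-⊠ id₁ u) ⟨∙ d ⟩
    ((id₁ ⊠ u) †M) ∙ (m †M)  ≡⟨ sym (†-∙ m (id₁ ⊠ u)) ⟩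
    (m ∙ (id₁ ⊠ u)) †M       ≡⟨ cong _†M μ-unitʳM ⟩
    id₁ †M                   ≡⟨ †-idM ⟩
    id₁                      ∎

  δ-cocommM : σM ∙ d ≡ d
  δ-cocommM = begin
    σM ∙ d              ≡⟨ sym σ†M ⟨∙ d ⟩
    (σM †M) ∙ (m †M)    ≡⟨ sym (†-∙ m σM) ⟩
    (m ∙ σM) †M         ≡⟨ cong _†M μ-commM ⟩
    d                   ∎

  copyable-multiplyˡ : (p : Mor 0 1) → d ∙ p ≡ p ⊠ p → m ∙ (p ⊠ id₁) ≡ p ∙ (e ∙ m ∙ (p ⊠ id₁))
  copyable-multiplyˡ p copy = begin
    m ∙ (p ⊠ id₁)                                      ≡⟨ sym (∙-idl _) ⟩
    id₁ ∙ m ∙ (p ⊠ id₁)                                ≡⟨ sym δ-counitʳM ⟨∙ _ ⟩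
    ((id₁ ⊠ e) ∙ d) ∙ m ∙ (p ⊠ id₁)                    ≡⟨ ∙-assoc _ _ _ ⟩
    (id₁ ⊠ e) ∙ d ∙ m ∙ (p ⊠ id₁)                      ≡⟨ (id₁ ⊠ e) ∙⟩ sym (∙-assoc _ _ _) ⟩
    (id₁ ⊠ e) ∙ (d ∙ m) ∙ (p ⊠ id₁)                    ≡⟨ (id₁ ⊠ e) ∙⟩ (sym frobeniusʳM ⟨∙ _) ⟩
    (id₁ ⊠ e) ∙ ((id₁ ⊠ m) ∙ (d ⊠ id₁)) ∙ (p ⊠ id₁)    ≡⟨ (id₁ ⊠ e) ∙⟩ ∙-assoc _ _ _ ⟩
    (id₁ ⊠ e) ∙ (id₁ ⊠ m) ∙ (d ⊠ id₁) ∙ (p ⊠ id₁)      ≡⟨ (id₁ ⊠ e) ∙⟩ ((id₁ ⊠ m) ∙⟩ ⊠-∙ d id₁ p id₁) ⟩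
    (id₁ ⊠ e) ∙ (id₁ ⊠ m) ∙ ((d ∙ p) ⊠ (id₁ ∙ id₁))    ≡⟨ (id₁ ⊠ e) ∙⟩ ((id₁ ⊠ m) ∙⟩ ⊠≡ copy (∙-idl id₁)) ⟩
    (id₁ ⊠ e) ∙ (id₁ ⊠ m) ∙ ((p ⊠ p) ⊠ id₁)            ≡⟨ (id₁ ⊠ e) ∙⟩ ((id₁ ⊠ m) ∙⟩ ⊠-assoc p p id₁) ⟩
    (id₁ ⊠ e) ∙ (id₁ ⊠ m) ∙ (p ⊠ (p ⊠ id₁))            ≡⟨ (id₁ ⊠ e) ∙⟩ ⊠-∙ id₁ m p (p ⊠ id₁) ⟩
    (id₁ ⊠ e) ∙ ((id₁ ∙ p) ⊠ (m ∙ (p ⊠ id₁)))          ≡⟨ ⊠-∙ id₁ e (id₁ ∙ p) (m ∙ (p ⊠ id₁)) ⟩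
    (id₁ ∙ id₁ ∙ p) ⊠ (e ∙ m ∙ (p ⊠ id₁))              ≡⟨ ⊠≡ (trans (∙-idl _) (∙-idl _)) refl ⟩
    p ⊠ (e ∙ m ∙ (p ⊠ id₁))                            ≡⟨ state⊠effect p _ ⟩
    p ∙ (e ∙ m ∙ (p ⊠ id₁))                            ∎

  copyable-multiplyʳ : (p : Mor 0 1) → d ∙ p ≡ p ⊠ p → m ∙ (id₁ ⊠ p) ≡ p ∙ (e ∙ m ∙ (id₁ ⊠ p))
  copyable-multiplyʳ p copy = begin
    m ∙ (id₁ ⊠ p)                                      ≡⟨ sym (∙-idl _) ⟩
    id₁ ∙ m ∙ (id₁ ⊠ p)                                ≡⟨ sym δ-counitˡM ⟨∙ _ ⟩
    ((e ⊠ id₁) ∙ d) ∙ m ∙ (id₁ ⊠ p)                    ≡⟨ ∙-assoc _ _ _ ⟩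
    (e ⊠ id₁) ∙ d ∙ m ∙ (id₁ ⊠ p)                      ≡⟨ (e ⊠ id₁) ∙⟩ sym (∙-assoc _ _ _) ⟩
    (e ⊠ id₁) ∙ (d ∙ m) ∙ (id₁ ⊠ p)                    ≡⟨ (e ⊠ id₁) ∙⟩ (sym frobeniusˡM ⟨∙ _) ⟩
    (e ⊠ id₁) ∙ ((m ⊠ id₁) ∙ (id₁ ⊠ d)) ∙ (id₁ ⊠ p)    ≡⟨ (e ⊠ id₁) ∙⟩ ∙-assoc _ _ _ ⟩
    (e ⊠ id₁) ∙ (m ⊠ id₁) ∙ (id₁ ⊠ d) ∙ (id₁ ⊠ p)      ≡⟨ (e ⊠ id₁) ∙⟩ ((m ⊠ id₁) ∙⟩ ⊠-∙ id₁ d id₁ p) ⟩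
    (e ⊠ id₁) ∙ (m ⊠ id₁) ∙ ((id₁ ∙ id₁) ⊠ (d ∙ p))    ≡⟨ (e ⊠ id₁) ∙⟩ ((m ⊠ id₁) ∙⟩ ⊠≡ (∙-idl id₁) copy) ⟩
    (e ⊠ id₁) ∙ (m ⊠ id₁) ∙ (id₁ ⊠ (p ⊠ p))            ≡⟨ (e ⊠ id₁) ∙⟩ ((m ⊠ id₁) ∙⟩ sym (⊠-assoc id₁ p p)) ⟩
    (e ⊠ id₁) ∙ (m ⊠ id₁) ∙ ((id₁ ⊠ p) ⊠ p)            ≡⟨ (e ⊠ id₁) ∙⟩ ⊠-∙ m id₁ (id₁ ⊠ p) p ⟩
    (e ⊠ id₁) ∙ ((m ∙ (id₁ ⊠ p)) ⊠ (id₁ ∙ p))          ≡⟨ ⊠-∙ e id₁ (m ∙ (id₁ ⊠ p)) (id₁ ∙ p) ⟩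
    (e ∙ m ∙ (id₁ ⊠ p)) ⊠ (id₁ ∙ id₁ ∙ p)              ≡⟨ ⊠≡ refl (trans (∙-idl _) (∙-idl _)) ⟩
    (e ∙ m ∙ (id₁ ⊠ p)) ⊠ p                            ≡⟨ effect⊠state _ p ⟩
    p ∙ (e ∙ m ∙ (id₁ ⊠ p))                            ∎

  μ-unitˡ-beside : (m ⊠ id₁) ∙ (u ⊠ id₂) ≡ id₂
  μ-unitˡ-beside = begin
    (m ⊠ id₁) ∙ (u ⊠ id₂)          ≡⟨ (m ⊠ id₁) ∙⟩ trans (⊠≡ refl (sym ⊠-id)) (sym (⊠-assoc u id₁ id₁)) ⟩
    (m ⊠ id₁) ∙ ((u ⊠ id₁) ⊠ id₁)  ≡⟨ ⊠-∙ m id₁ (u ⊠ id₁) id₁ ⟩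
    (m ∙ (u ⊠ id₁)) ⊠ (id₁ ∙ id₁)  ≡⟨ ⊠≡ μ-unitˡM (∙-idl id₁) ⟩
    id₁ ⊠ id₁                      ≡⟨ ⊠-id ⟩
    id₂                            ∎

  μ-assoc-beside : (m ⊠ id₁) ∙ (m ⊠ id₂) ≡ (m ⊠ id₁) ∙ (id₁ ⊠ (m ⊠ id₁))
  μ-assoc-beside = begin
    (m ⊠ id₁) ∙ (m ⊠ id₂)          ≡⟨ (m ⊠ id₁) ∙⟩ trans (⊠≡ refl (sym ⊠-id)) (sym (⊠-assoc m id₁ id₁)) ⟩
    (m ⊠ id₁) ∙ ((m ⊠ id₁) ⊠ id₁)  ≡⟨ ⊠-∙ m id₁ (m ⊠ id₁) id₁ ⟩
    (m ∙ (m ⊠ id₁)) ⊠ (id₁ ∙ id₁)  ≡⟨ ⊠≡ μ-assocM refl ⟩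
    (m ∙ (id₁ ⊠ m)) ⊠ (id₁ ∙ id₁)  ≡⟨ ∙-⊠ m id₁ (id₁ ⊠ m) id₁ ⟩
    (m ⊠ id₁) ∙ ((id₁ ⊠ m) ⊠ id₁)  ≡⟨ (m ⊠ id₁) ∙⟩ ⊠-assoc id₁ m id₁ ⟩
    (m ⊠ id₁) ∙ (id₁ ⊠ (m ⊠ id₁))  ∎

  μ-unit-between : (f g : Mor 1 1) → (m ⊠ id₁) ∙ (f ⊠ (u ⊠ g)) ≡ f ⊠ g
  μ-unit-between f g = begin
    (m ⊠ id₁) ∙ (f ⊠ (u ⊠ g))  ≡⟨ (m ⊠ id₁) ∙⟩ sym (⊠-assoc f u g) ⟩
    (m ⊠ id₁) ∙ ((f ⊠ u) ⊠ g)  ≡⟨ ⊠-∙ m id₁ (f ⊠ u) g ⟩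
    (m ∙ (f ⊠ u)) ⊠ (id₁ ∙ g)  ≡⟨ ⊠≡ m∙f⊠u≡f (∙-idl g) ⟩
    f ⊠ g                      ∎
    where
    m∙f⊠u≡f : m ∙ (f ⊠ u) ≡ f
    m∙f⊠u≡f = begin
      m ∙ (f ⊠ u)                 ≡⟨ m ∙⟩ trans (⊠≡ (sym (∙-idl f)) (sym (∙-idr u))) (∙-⊠ id₁ u f id₀) ⟩
      m ∙ (id₁ ⊠ u) ∙ (f ⊠ id₀)   ≡⟨ sym (∙-assoc _ _ _) ⟩
      (m ∙ (id₁ ⊠ u)) ∙ (f ⊠ id₀) ≡⟨ cong₂ _∙_ μ-unitʳM (⊠-unitʳ f) ⟩
      id₁ ∙ f                     ≡⟨ ∙-idl f ⟩
      f                           ∎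

  counit-insert : (p : Mor 0 1) (X : Mor 1 2) → (p ⊠ id₂) ∙ X ≡ ((p ∙ e) ⊠ X) ∙ d
  counit-insert p X = begin
    (p ⊠ id₂) ∙ X              ≡⟨ (p ⊠ id₂) ∙⟩ sym (⊠-unitˡ X) ⟩
    (p ⊠ id₂) ∙ (id₀ ⊠ X)      ≡⟨ ⊠-∙ p id₂ id₀ X ⟩
    (p ∙ id₀) ⊠ (id₂ ∙ X)      ≡⟨ ⊠≡ (∙-idr p) (∙-idl X) ⟩
    p ⊠ X                      ≡⟨ sym (∙-idr (p ⊠ X)) ⟩
    (p ⊠ X) ∙ id₁              ≡⟨ (p ⊠ X) ∙⟩ sym δ-counitˡM ⟩
    (p ⊠ X) ∙ (e ⊠ id₁) ∙ d    ≡⟨ sym (∙-assoc _ _ _) ⟩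
    ((p ⊠ X) ∙ (e ⊠ id₁)) ∙ d  ≡⟨ trans (⊠-∙ p X e id₁) (⊠≡ refl (∙-idr X)) ⟨∙ d ⟩
    ((p ∙ e) ⊠ X) ∙ d          ∎

  snakeˡ : ((e ∙ m) ⊠ id₁) ∙ (id₁ ⊠ (d ∙ u)) ≡ id₁
  snakeˡ = begin
    ((e ∙ m) ⊠ id₁) ∙ (id₁ ⊠ (d ∙ u))
      ≡⟨ cong₂ _∙_ (⊠≡ refl (sym (∙-idl id₁))) (⊠≡ (sym (∙-idl id₁)) refl) ⟩
    ((e ∙ m) ⊠ (id₁ ∙ id₁)) ∙ ((id₁ ∙ id₁) ⊠ (d ∙ u))
      ≡⟨ cong₂ _∙_ (∙-⊠ e id₁ m id₁) (∙-⊠ id₁ d id₁ u) ⟩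
    ((e ⊠ id₁) ∙ (m ⊠ id₁)) ∙ ((id₁ ⊠ d) ∙ (id₁ ⊠ u)) ≡⟨ ∙-assoc _ _ _ ⟩
    (e ⊠ id₁) ∙ (m ⊠ id₁) ∙ (id₁ ⊠ d) ∙ (id₁ ⊠ u)     ≡⟨ (e ⊠ id₁) ∙⟩ sym (∙-assoc _ _ _) ⟩
    (e ⊠ id₁) ∙ ((m ⊠ id₁) ∙ (id₁ ⊠ d)) ∙ (id₁ ⊠ u)   ≡⟨ (e ⊠ id₁) ∙⟩ (frobeniusˡM ⟨∙ _) ⟩
    (e ⊠ id₁) ∙ (d ∙ m) ∙ (id₁ ⊠ u)                   ≡⟨ (e ⊠ id₁) ∙⟩ ∙-assoc _ _ _ ⟩
    (e ⊠ id₁) ∙ d ∙ m ∙ (id₁ ⊠ u)                     ≡⟨ (e ⊠ id₁) ∙⟩ (d ∙⟩ μ-unitʳM) ⟩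
    (e ⊠ id₁) ∙ d ∙ id₁                               ≡⟨ (e ⊠ id₁) ∙⟩ ∙-idr d ⟩
    (e ⊠ id₁) ∙ d                                     ≡⟨ δ-counitˡM ⟩
    id₁                                               ∎

  snakeʳ : (id₁ ⊠ (e ∙ m)) ∙ ((d ∙ u) ⊠ id₁) ≡ id₁
  snakeʳ = begin
    (id₁ ⊠ (e ∙ m)) ∙ ((d ∙ u) ⊠ id₁)
      ≡⟨ cong₂ _∙_ (⊠≡ (sym (∙-idl id₁)) refl) (⊠≡ refl (sym (∙-idl id₁))) ⟩
    ((id₁ ∙ id₁) ⊠ (e ∙ m)) ∙ ((d ∙ u) ⊠ (id₁ ∙ id₁))
      ≡⟨ cong₂ _∙_ (∙-⊠ id₁ e id₁ m) (∙-⊠ d id₁ u id₁) ⟩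
    ((id₁ ⊠ e) ∙ (id₁ ⊠ m)) ∙ ((d ⊠ id₁) ∙ (u ⊠ id₁)) ≡⟨ ∙-assoc _ _ _ ⟩
    (id₁ ⊠ e) ∙ (id₁ ⊠ m) ∙ (d ⊠ id₁) ∙ (u ⊠ id₁)     ≡⟨ (id₁ ⊠ e) ∙⟩ sym (∙-assoc _ _ _) ⟩
    (id₁ ⊠ e) ∙ ((id₁ ⊠ m) ∙ (d ⊠ id₁)) ∙ (u ⊠ id₁)   ≡⟨ (id₁ ⊠ e) ∙⟩ (frobeniusʳM ⟨∙ _) ⟩
    (id₁ ⊠ e) ∙ (d ∙ m) ∙ (u ⊠ id₁)                   ≡⟨ (id₁ ⊠ e) ∙⟩ ∙-assoc _ _ _ ⟩
    (id₁ ⊠ e) ∙ d ∙ m ∙ (u ⊠ id₁)                     ≡⟨ (id₁ ⊠ e) ∙⟩ (d ∙⟩ μ-unitˡM) ⟩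
    (id₁ ⊠ e) ∙ d ∙ id₁                               ≡⟨ (id₁ ⊠ e) ∙⟩ ∙-idr d ⟩
    (id₁ ⊠ e) ∙ d                                     ≡⟨ δ-counitʳM ⟩
    id₁                                               ∎

module HopfLaw {o ℓ} (𝒞 : StrictSymMonDaggerCat o ℓ) {A : StrictSymMonDaggerCat.Obj 𝒞}
               (F : IFStructure 𝒞 A) where
  open StrictSymMonDaggerCat 𝒞
  open Coherence 𝒞
  open TensorPowers 𝒞 A
  open IFStructure F
  open ≡-Reasoning
  module G = FrobeniusLaws 𝒞 green
  module R = FrobeniusLaws 𝒞 red
  open G using (m; u; d; e)
  open R using () renaming (m to M; u to U; d to D; e to E)

  middle-swapM≅ : un middle-swapM ≅ middle-swap {A} {A} {A} {A}
  middle-swapM≅ = ≅-trans (≅-⊠ ≅-refl (un-⊠ σM id₁))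
                          (≅-sym (absorbˡ α⁻¹≅id (absorbʳ (≅-⊗ ≅-refl (absorbˡ α≅id (absorbʳ ≅-refl α⁻¹≅id))) α≅id)))

  bialg-δμM : d ∙ M ≡ (M ⊠ M) ∙ middle-swapM ∙ (d ⊠ d)
  bialg-δμM = Mor-≅ (≅-trans (≅-∙ ≅-refl ≅-refl) (≡⇒≅ bialg-δμ))
                    (≅-∙ (un-⊠ M M) (≅-∙ middle-swapM≅ (un-⊠ d d)))

  bialg-δηM : d ∙ U ≡ U ⊠ U
  bialg-δηM = Mor-≅ (≅-trans (≅-∙ ≅-refl ≅-refl) (≅-trans (≡⇒≅ bialg-δη) (absorbʳ ≅-refl λ⁻¹≅id)))
                    (un-⊠ U U)

  bialg-εμM : e ∙ M ≡ e ⊠ e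
  bialg-εμM = Mor-≅ (≅-trans (≅-∙ ≅-refl ≅-refl) (≅-trans (≡⇒≅ bialg-εμ) (absorbˡ λ≅id ≅-refl)))
                    (un-⊠ e e)

  ηr-defM : U ≡ (E ⊠ id₁) ∙ d ∙ u
  ηr-defM = Mor-≅ (≅-trans (≡⇒≅ ηr-def) (absorbˡ λ≅id ≅-refl))
                  (≅-∙ (un-⊠ E id₁) (≅-∙ ≅-refl ≅-refl))

  εg-defM : e ≡ E ∙ M ∙ (id₁ ⊠ u)
  εg-defM = Mor-≅ (≅-trans (≡⇒≅ εg-def) (≅-∘ ≅-refl (≅-∘ ≅-refl (absorbʳ ≅-refl ρ⁻¹≅id))))
                  (≅-∙ ≅-refl (≅-∙ ≅-refl (un-⊠ id₁ u)))
  cupᵍ : Mor 0 2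
  cupᵍ = d ∙ u
  cupʳ : Mor 0 2
  cupʳ = D ∙ U

  -- The antipode s (green cap, red cup) and its mirror image S (red cap,
  -- green cup).
  s : Mor 1 1
  s = transpose (e ∙ m) cupʳ
  S : Mor 1 1
  S = transpose (E ∙ M) cupᵍ

  -- Daggers of the IF axioms.
  δʳ-copies-ηᵍ : D ∙ u ≡ u ⊠ u
  δʳ-copies-ηᵍ = begin
    D ∙ u            ≡⟨ cong (D ∙_) (sym (†-involutiveM u)) ⟩
    (M †M) ∙ (e †M)  ≡⟨ sym (†-∙ e M) ⟩
    (e ∙ M) †M       ≡⟨ cong _†M bialg-εμM ⟩
    (e ⊠ e) †M       ≡⟨ †-⊠ e e ⟩
    (e †M) ⊠ (e †M)  ≡⟨ ⊠≡ (†-involutiveM u) (†-involutiveM u) ⟩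
    u ⊠ u            ∎

  εʳ-via-εᵍ : E ≡ e ∙ m ∙ (U ⊠ id₁)
  εʳ-via-εᵍ = begin
    E                                         ≡⟨ cong _†M ηr-defM ⟩
    ((E ⊠ id₁) ∙ d ∙ u) †M                    ≡⟨ †-∙ (E ⊠ id₁) (d ∙ u) ⟩
    ((d ∙ u) †M) ∙ ((E ⊠ id₁) †M)             ≡⟨ cong₂ _∙_ (†-∙ d u) (†-⊠ E id₁) ⟩
    ((u †M) ∙ (d †M)) ∙ ((E †M) ⊠ (id₁ †M))   ≡⟨ cong₂ _∙_ (cong (e ∙_) (†-involutiveM m)) (⊠≡ (†-involutiveM U) †-idM) ⟩
    (e ∙ m) ∙ (U ⊠ id₁)                       ≡⟨ ∙-assoc e m (U ⊠ id₁) ⟩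
    e ∙ m ∙ (U ⊠ id₁)                         ∎

  εᵍ-caps-cupʳ : (id₁ ⊠ e) ∙ cupʳ ≡ u
  εᵍ-caps-cupʳ = begin
    (id₁ ⊠ e) ∙ D ∙ U                     ≡⟨ cong₂ _∙_ (⊠≡ (sym †-idM) refl) (cong (D ∙_) (sym (†-involutiveM U))) ⟩
    ((id₁ †M) ⊠ (u †M)) ∙ (M †M) ∙ (E †M) ≡⟨ cong₂ _∙_ (sym (†-⊠ id₁ u)) (sym (†-∙ E M)) ⟩
    ((id₁ ⊠ u) †M) ∙ ((E ∙ M) †M)         ≡⟨ sym (†-∙ (E ∙ M) (id₁ ⊠ u)) ⟩
    ((E ∙ M) ∙ (id₁ ⊠ u)) †M              ≡⟨ cong _†M (trans (∙-assoc E M (id₁ ⊠ u)) (sym εg-defM)) ⟩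
    e †M                                  ≡⟨ †-involutiveM u ⟩
    u                                     ∎

  -- Multiplying by the unit of the other colour gives a constant map,
  -- since that unit is copied (bialgebra) and the IF axioms identify the
  -- resulting scalar effect.
  μᵍ-ηʳ-constant : m ∙ (U ⊠ id₁) ≡ U ∙ E
  μᵍ-ηʳ-constant = trans (G.copyable-multiplyˡ U bialg-δηM) (cong (U ∙_) (sym εʳ-via-εᵍ))

  μʳ-ηᵍ-constant : M ∙ (id₁ ⊠ u) ≡ u ∙ e
  μʳ-ηᵍ-constant = trans (R.copyable-multiplyʳ u δʳ-copies-ηᵍ) (cong (u ∙_) (sym εg-defM))

  δᵍ-εʳ-constant : (E ⊠ id₁) ∙ d ≡ U ∙ E
  δᵍ-εʳ-constant = begin
    (E ⊠ id₁) ∙ d                ≡⟨ cong (λ z → (E ⊠ z) ∙ d) (sym †-idM) ⟩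
    ((U †M) ⊠ (id₁ †M)) ∙ (m †M) ≡⟨ sym (†-⊠ U id₁) ⟨∙ (m †M) ⟩
    ((U ⊠ id₁) †M) ∙ (m †M)      ≡⟨ sym (†-∙ m (U ⊠ id₁)) ⟩
    (m ∙ (U ⊠ id₁)) †M           ≡⟨ cong _†M μᵍ-ηʳ-constant ⟩
    (U ∙ E) †M                   ≡⟨ †-∙ U E ⟩
    (E †M) ∙ (U †M)              ≡⟨ †-involutiveM U ⟨∙ E ⟩
    U ∙ E                        ∎

  εʳ-δᵍ-μʳ : (E ⊠ id₁) ∙ d ∙ M ≡ ((E ∙ M) ⊠ M) ∙ middle-swapM ∙ (d ⊠ d)
  εʳ-δᵍ-μʳ = begin
    (E ⊠ id₁) ∙ d ∙ M                              ≡⟨ (E ⊠ id₁) ∙⟩ bialg-δμM ⟩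
    (E ⊠ id₁) ∙ (M ⊠ M) ∙ middle-swapM ∙ (d ⊠ d)   ≡⟨ sym (∙-assoc _ _ _) ⟩
    ((E ⊠ id₁) ∙ (M ⊠ M)) ∙ middle-swapM ∙ (d ⊠ d) ≡⟨ trans (⊠-∙ E id₁ M M) (⊠≡ refl (∙-idl M)) ⟨∙ _ ⟩
    ((E ∙ M) ⊠ M) ∙ middle-swapM ∙ (d ⊠ d)         ∎

  ηʳ-εʳ-μʳ : U ∙ E ∙ M ≡ ((E ∙ M) ⊠ M) ∙ middle-swapM ∙ (d ⊠ d)
  ηʳ-εʳ-μʳ = begin
    U ∙ E ∙ M           ≡⟨ sym (∙-assoc _ _ _) ⟩
    (U ∙ E) ∙ M         ≡⟨ sym δᵍ-εʳ-constant ⟨∙ M ⟩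
    ((E ⊠ id₁) ∙ d) ∙ M ≡⟨ ∙-assoc _ _ _ ⟩
    (E ⊠ id₁) ∙ d ∙ M   ≡⟨ εʳ-δᵍ-μʳ ⟩
    ((E ∙ M) ⊠ M) ∙ middle-swapM ∙ (d ⊠ d) ∎

  δ⊠δ-ηᵍ : (d ⊠ d) ∙ (id₁ ⊠ u) ≡ (σM ⊠ id₂) ∙ (d ⊠ cupᵍ)
  δ⊠δ-ηᵍ = begin
    (d ⊠ d) ∙ (id₁ ⊠ u)      ≡⟨ ⊠-∙ d d id₁ u ⟩
    (d ∙ id₁) ⊠ cupᵍ         ≡⟨ ⊠≡ (trans (∙-idr d) (sym G.δ-cocommM)) (sym (∙-idl cupᵍ)) ⟩
    (σM ∙ d) ⊠ (id₂ ∙ cupᵍ)  ≡⟨ ∙-⊠ σM id₂ d cupᵍ ⟩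
    (σM ⊠ id₂) ∙ (d ⊠ cupᵍ)  ∎

  -- The Hopf law for the mirror antipode S, directly from the bialgebra law:
  -- ηʳ εᵍ = (εʳ ⊗ id) δᵍ μʳ (id ⊗ ηᵍ), then slide the red cap into place.
  hopf-S : U ∙ e ≡ M ∙ (id₁ ⊠ S) ∙ d
  hopf-S = begin
    U ∙ e                                                ≡⟨ ηr-defM ⟨∙ e ⟩
    ((E ⊠ id₁) ∙ d ∙ u) ∙ e                              ≡⟨ trans (∙-assoc _ _ _) ((E ⊠ id₁) ∙⟩ ∙-assoc _ _ _) ⟩
    (E ⊠ id₁) ∙ d ∙ u ∙ e                                ≡⟨ (E ⊠ id₁) ∙⟩ (d ∙⟩ sym μʳ-ηᵍ-constant) ⟩
    (E ⊠ id₁) ∙ d ∙ M ∙ (id₁ ⊠ u)                        ≡⟨ trans ((E ⊠ id₁) ∙⟩ sym (∙-assoc _ _ _)) (sym (∙-assoc _ _ _)) ⟩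
    ((E ⊠ id₁) ∙ (d ∙ M)) ∙ (id₁ ⊠ u)                    ≡⟨ εʳ-δᵍ-μʳ ⟨∙ (id₁ ⊠ u) ⟩
    (((E ∙ M) ⊠ M) ∙ middle-swapM ∙ (d ⊠ d)) ∙ (id₁ ⊠ u) ≡⟨ trans (∙-assoc _ _ _) (((E ∙ M) ⊠ M) ∙⟩ ∙-assoc _ _ _) ⟩
    ((E ∙ M) ⊠ M) ∙ middle-swapM ∙ (d ⊠ d) ∙ (id₁ ⊠ u)   ≡⟨ ((E ∙ M) ⊠ M) ∙⟩ (middle-swapM ∙⟩ δ⊠δ-ηᵍ) ⟩
    ((E ∙ M) ⊠ M) ∙ middle-swapM ∙ (σM ⊠ id₂) ∙ (d ⊠ cupᵍ)
      ≡⟨ trans (((E ∙ M) ⊠ M) ∙⟩ sym (∙-assoc _ _ _)) (sym (∙-assoc _ _ _)) ⟩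
    (((E ∙ M) ⊠ M) ∙ (middle-swapM ∙ (σM ⊠ id₂))) ∙ (d ⊠ cupᵍ) ≡⟨ cap-slide (E ∙ M) M ⟨∙ (d ⊠ cupᵍ) ⟩
    (M ∙ (id₁ ⊠ ((E ∙ M) ⊠ id₁))) ∙ (d ⊠ cupᵍ)           ≡⟨ ∙-assoc _ _ _ ⟩
    M ∙ (id₁ ⊠ ((E ∙ M) ⊠ id₁)) ∙ (d ⊠ cupᵍ)             ≡⟨ M ∙⟩ ((id₁ ⊠ ((E ∙ M) ⊠ id₁)) ∙⟩ sym (state-right d cupᵍ)) ⟩
    M ∙ (id₁ ⊠ ((E ∙ M) ⊠ id₁)) ∙ (id₁ ⊠ (id₁ ⊠ cupᵍ)) ∙ d ≡⟨ M ∙⟩ sym (∙-assoc _ _ _) ⟩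
    M ∙ ((id₁ ⊠ ((E ∙ M) ⊠ id₁)) ∙ (id₁ ⊠ (id₁ ⊠ cupᵍ))) ∙ d
      ≡⟨ M ∙⟩ (trans (⊠-∙ id₁ ((E ∙ M) ⊠ id₁) id₁ (id₁ ⊠ cupᵍ)) (⊠≡ (∙-idl id₁) refl) ⟨∙ d) ⟩
    M ∙ (id₁ ⊠ S) ∙ d                                    ∎

  -- The same with S on the other input, as μr is commutative and δg
  -- cocommutative.
  hopf-S′ : U ∙ e ≡ M ∙ (S ⊠ id₁) ∙ d
  hopf-S′ = begin
    U ∙ e                      ≡⟨ hopf-S ⟩
    M ∙ (id₁ ⊠ S) ∙ d          ≡⟨ sym R.μ-commM ⟨∙ _ ⟩
    (M ∙ σM) ∙ (id₁ ⊠ S) ∙ d   ≡⟨ trans (∙-assoc _ _ _) (M ∙⟩ sym (∙-assoc _ _ _)) ⟩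
    M ∙ (σM ∙ (id₁ ⊠ S)) ∙ d   ≡⟨ M ∙⟩ (σ-naturalM id₁ S ⟨∙ d) ⟩
    M ∙ ((S ⊠ id₁) ∙ σM) ∙ d   ≡⟨ M ∙⟩ ∙-assoc _ _ _ ⟩
    M ∙ (S ⊠ id₁) ∙ σM ∙ d     ≡⟨ M ∙⟩ ((S ⊠ id₁) ∙⟩ G.δ-cocommM) ⟩
    M ∙ (S ⊠ id₁) ∙ d          ∎

  cup³ : Mor 0 3
  cup³ = (id₁ ⊠ d) ∙ cupᵍ

  cup³-left : (d ⊠ id₁) ∙ cupᵍ ≡ cup³
  cup³-left = trans (sym (∙-assoc _ _ _)) (trans (G.δ-coassocM ⟨∙ u) (∙-assoc _ _ _))

  δ∙S-expanded : d ∙ S ≡ ((E ∙ M) ⊠ id₂) ∙ (id₁ ⊠ cup³)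
  δ∙S-expanded = begin
    d ∙ ((E ∙ M) ⊠ id₁) ∙ (id₁ ⊠ cupᵍ)         ≡⟨ sym (∙-assoc _ _ _) ⟩
    (d ∙ ((E ∙ M) ⊠ id₁)) ∙ (id₁ ⊠ cupᵍ)       ≡⟨ δ-past-cap ⟨∙ (id₁ ⊠ cupᵍ) ⟩
    (((E ∙ M) ⊠ id₂) ∙ (id₂ ⊠ d)) ∙ (id₁ ⊠ cupᵍ) ≡⟨ ∙-assoc _ _ _ ⟩
    ((E ∙ M) ⊠ id₂) ∙ (id₂ ⊠ d) ∙ (id₁ ⊠ cupᵍ) ≡⟨ ((E ∙ M) ⊠ id₂) ∙⟩ δ-onto-cup ⟩
    ((E ∙ M) ⊠ id₂) ∙ (id₁ ⊠ cup³)             ∎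
    where
    δ-past-cap : d ∙ ((E ∙ M) ⊠ id₁) ≡ ((E ∙ M) ⊠ id₂) ∙ (id₂ ⊠ d)
    δ-past-cap = begin
      d ∙ ((E ∙ M) ⊠ id₁)          ≡⟨ sym (⊠-unitˡ d) ⟨∙ ((E ∙ M) ⊠ id₁) ⟩
      (id₀ ⊠ d) ∙ ((E ∙ M) ⊠ id₁)  ≡⟨ ⊠-∙ id₀ d (E ∙ M) id₁ ⟩
      (id₀ ∙ E ∙ M) ⊠ (d ∙ id₁)    ≡⟨ ⊠≡ (trans (∙-idl _) (sym (∙-idr _))) (trans (∙-idr d) (sym (∙-idl d))) ⟩
      ((E ∙ M) ∙ id₂) ⊠ (id₂ ∙ d)  ≡⟨ ∙-⊠ (E ∙ M) id₂ id₂ d ⟩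
      ((E ∙ M) ⊠ id₂) ∙ (id₂ ⊠ d)  ∎
    δ-onto-cup : (id₂ ⊠ d) ∙ (id₁ ⊠ cupᵍ) ≡ id₁ ⊠ cup³
    δ-onto-cup = begin
      (id₂ ⊠ d) ∙ (id₁ ⊠ cupᵍ)          ≡⟨ trans (⊠≡ (sym ⊠-id) refl) (⊠-assoc id₁ id₁ d) ⟨∙ (id₁ ⊠ cupᵍ) ⟩
      (id₁ ⊠ (id₁ ⊠ d)) ∙ (id₁ ⊠ cupᵍ)  ≡⟨ ⊠-∙ id₁ (id₁ ⊠ d) id₁ cupᵍ ⟩
      (id₁ ∙ id₁) ⊠ cup³                ≡⟨ ⊠≡ (∙-idl id₁) refl ⟩
      id₁ ⊠ cup³                        ∎

  δ⊠δ-cupᵍ : ((d ⊠ d) ⊠ id₁) ∙ (id₁ ⊠ cupᵍ) ≡ ((σM ⊠ id₂) ⊠ id₁) ∙ (d ⊠ cup³)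
  δ⊠δ-cupᵍ = begin
    ((d ⊠ d) ⊠ id₁) ∙ (id₁ ⊠ cupᵍ)  ≡⟨ ⊠-assoc d d id₁ ⟨∙ (id₁ ⊠ cupᵍ) ⟩
    (d ⊠ (d ⊠ id₁)) ∙ (id₁ ⊠ cupᵍ)  ≡⟨ ⊠-∙ d (d ⊠ id₁) id₁ cupᵍ ⟩
    (d ∙ id₁) ⊠ ((d ⊠ id₁) ∙ cupᵍ)  ≡⟨ ⊠≡ (trans (∙-idr d) (sym G.δ-cocommM)) (trans cup³-left (sym (∙-idl cup³))) ⟩
    (σM ∙ d) ⊠ (id₃ ∙ cup³)         ≡⟨ ∙-⊠ σM id₃ d cup³ ⟩
    (σM ⊠ id₃) ∙ (d ⊠ cup³)         ≡⟨ trans (⊠≡ refl (sym ⊠-id)) (sym (⊠-assoc σM id₂ id₁)) ⟨∙ (d ⊠ cup³) ⟩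
    ((σM ⊠ id₂) ⊠ id₁) ∙ (d ⊠ cup³) ∎

  μʳ-capʳ : Mor 5 2
  μʳ-capʳ = (M ⊠ id₁) ∙ (id₁ ⊠ ((E ∙ M) ⊠ id₂))

  cap-slide-beside : (((E ∙ M) ⊠ M) ⊠ id₁) ∙ (middle-swapM ⊠ id₁) ∙ ((σM ⊠ id₂) ⊠ id₁) ≡ μʳ-capʳ
  cap-slide-beside = begin
    (X ⊠ id₁) ∙ (middle-swapM ⊠ id₁) ∙ ((σM ⊠ id₂) ⊠ id₁)
      ≡⟨ (X ⊠ id₁) ∙⟩ ⊠-∙ middle-swapM id₁ (σM ⊠ id₂) id₁ ⟩
    (X ⊠ id₁) ∙ ((middle-swapM ∙ (σM ⊠ id₂)) ⊠ (id₁ ∙ id₁))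
      ≡⟨ ⊠-∙ X id₁ (middle-swapM ∙ (σM ⊠ id₂)) (id₁ ∙ id₁) ⟩
    (X ∙ middle-swapM ∙ (σM ⊠ id₂)) ⊠ (id₁ ∙ id₁ ∙ id₁)
      ≡⟨ ⊠≡ (cap-slide (E ∙ M) M) (∙-idl _) ⟩
    (M ∙ (id₁ ⊠ ((E ∙ M) ⊠ id₁))) ⊠ (id₁ ∙ id₁)
      ≡⟨ ∙-⊠ M id₁ (id₁ ⊠ ((E ∙ M) ⊠ id₁)) id₁ ⟩
    (M ⊠ id₁) ∙ ((id₁ ⊠ ((E ∙ M) ⊠ id₁)) ⊠ id₁)
      ≡⟨ (M ⊠ id₁) ∙⟩ trans (⊠-assoc id₁ ((E ∙ M) ⊠ id₁) id₁) (⊠≡ refl (trans (⊠-assoc (E ∙ M) id₁ id₁) (⊠≡ refl ⊠-id))) ⟩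
    μʳ-capʳ ∎
    where
    X = (E ∙ M) ⊠ M

  S-interaction-lhs : (M ⊠ id₁) ∙ (id₁ ⊠ (d ∙ S)) ∙ d ≡ μʳ-capʳ ∙ (d ⊠ cup³)
  S-interaction-lhs = begin
    (M ⊠ id₁) ∙ (id₁ ⊠ (d ∙ S)) ∙ d
      ≡⟨ (M ⊠ id₁) ∙⟩ (cong (id₁ ⊠_) δ∙S-expanded ⟨∙ d) ⟩
    (M ⊠ id₁) ∙ (id₁ ⊠ (((E ∙ M) ⊠ id₂) ∙ (id₁ ⊠ cup³))) ∙ d
      ≡⟨ (M ⊠ id₁) ∙⟩ (trans (⊠≡ (sym (∙-idl id₁)) refl) (∙-⊠ id₁ ((E ∙ M) ⊠ id₂) id₁ (id₁ ⊠ cup³)) ⟨∙ d) ⟩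
    (M ⊠ id₁) ∙ ((id₁ ⊠ ((E ∙ M) ⊠ id₂)) ∙ (id₁ ⊠ (id₁ ⊠ cup³))) ∙ d
      ≡⟨ (M ⊠ id₁) ∙⟩ ∙-assoc _ _ _ ⟩
    (M ⊠ id₁) ∙ (id₁ ⊠ ((E ∙ M) ⊠ id₂)) ∙ (id₁ ⊠ (id₁ ⊠ cup³)) ∙ d
      ≡⟨ (M ⊠ id₁) ∙⟩ ((id₁ ⊠ ((E ∙ M) ⊠ id₂)) ∙⟩ state-right d cup³) ⟩
    (M ⊠ id₁) ∙ (id₁ ⊠ ((E ∙ M) ⊠ id₂)) ∙ (d ⊠ cup³)
      ≡⟨ sym (∙-assoc _ _ _) ⟩
    μʳ-capʳ ∙ (d ⊠ cup³) ∎

  S-interaction-rhs : U ⊠ S ≡ μʳ-capʳ ∙ (d ⊠ cup³)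
  S-interaction-rhs = begin
    U ⊠ S                                       ≡⟨ ⊠≡ (sym (∙-idr U)) (sym (∙-idl S)) ⟩
    (U ∙ id₀) ⊠ (id₁ ∙ S)                       ≡⟨ ∙-⊠ U id₁ id₀ S ⟩
    (U ⊠ id₁) ∙ (id₀ ⊠ S)                       ≡⟨ (U ⊠ id₁) ∙⟩ ⊠-unitˡ S ⟩
    (U ⊠ id₁) ∙ ((E ∙ M) ⊠ id₁) ∙ (id₁ ⊠ cupᵍ)  ≡⟨ sym (∙-assoc _ _ _) ⟩
    ((U ⊠ id₁) ∙ ((E ∙ M) ⊠ id₁)) ∙ (id₁ ⊠ cupᵍ)
      ≡⟨ trans (⊠-∙ U id₁ (E ∙ M) id₁) (⊠≡ ηʳ-εʳ-μʳ (∙-idl id₁)) ⟨∙ (id₁ ⊠ cupᵍ) ⟩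
    ((X ∙ middle-swapM ∙ (d ⊠ d)) ⊠ id₁) ∙ (id₁ ⊠ cupᵍ)
      ≡⟨ split-off-id ⟨∙ (id₁ ⊠ cupᵍ) ⟩
    ((X ⊠ id₁) ∙ (middle-swapM ⊠ id₁) ∙ ((d ⊠ d) ⊠ id₁)) ∙ (id₁ ⊠ cupᵍ)
      ≡⟨ trans (∙-assoc _ _ _) ((X ⊠ id₁) ∙⟩ ∙-assoc _ _ _) ⟩
    (X ⊠ id₁) ∙ (middle-swapM ⊠ id₁) ∙ ((d ⊠ d) ⊠ id₁) ∙ (id₁ ⊠ cupᵍ)
      ≡⟨ (X ⊠ id₁) ∙⟩ ((middle-swapM ⊠ id₁) ∙⟩ δ⊠δ-cupᵍ) ⟩
    (X ⊠ id₁) ∙ (middle-swapM ⊠ id₁) ∙ ((σM ⊠ id₂) ⊠ id₁) ∙ (d ⊠ cup³)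
      ≡⟨ trans ((X ⊠ id₁) ∙⟩ sym (∙-assoc _ _ _)) (sym (∙-assoc _ _ _)) ⟩
    ((X ⊠ id₁) ∙ (middle-swapM ⊠ id₁) ∙ ((σM ⊠ id₂) ⊠ id₁)) ∙ (d ⊠ cup³)
      ≡⟨ cap-slide-beside ⟨∙ (d ⊠ cup³) ⟩
    μʳ-capʳ ∙ (d ⊠ cup³) ∎
    where
    X = (E ∙ M) ⊠ M
    split-off-id : (X ∙ middle-swapM ∙ (d ⊠ d)) ⊠ id₁ ≡ (X ⊠ id₁) ∙ (middle-swapM ⊠ id₁) ∙ ((d ⊠ d) ⊠ id₁)
    split-off-id = begin
      (X ∙ middle-swapM ∙ (d ⊠ d)) ⊠ id₁
        ≡⟨ ⊠≡ refl (sym (trans (∙-idl _) (∙-idl _))) ⟩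
      (X ∙ middle-swapM ∙ (d ⊠ d)) ⊠ (id₁ ∙ id₁ ∙ id₁)
        ≡⟨ ∙-⊠ X id₁ (middle-swapM ∙ (d ⊠ d)) (id₁ ∙ id₁) ⟩
      (X ⊠ id₁) ∙ ((middle-swapM ∙ (d ⊠ d)) ⊠ (id₁ ∙ id₁))
        ≡⟨ (X ⊠ id₁) ∙⟩ ∙-⊠ middle-swapM id₁ (d ⊠ d) id₁ ⟩
      (X ⊠ id₁) ∙ (middle-swapM ⊠ id₁) ∙ ((d ⊠ d) ⊠ id₁) ∎

  S-interaction : (M ⊠ id₁) ∙ (id₁ ⊠ (d ∙ S)) ∙ d ≡ U ⊠ S
  S-interaction = trans S-interaction-lhs (sym S-interaction-rhs)

  S-comultiplicative : d ∙ S ≡ (S ⊠ S) ∙ d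
  S-comultiplicative = begin
    dS                                           ≡⟨ sym (∙-idl dS) ⟩
    id₂ ∙ dS                                     ≡⟨ sym R.μ-unitˡ-beside ⟨∙ dS ⟩
    ((M ⊠ id₁) ∙ (U ⊠ id₂)) ∙ dS                 ≡⟨ ∙-assoc _ _ _ ⟩
    (M ⊠ id₁) ∙ (U ⊠ id₂) ∙ dS                   ≡⟨ (M ⊠ id₁) ∙⟩ G.counit-insert U dS ⟩
    (M ⊠ id₁) ∙ ((U ∙ e) ⊠ dS) ∙ d               ≡⟨ (M ⊠ id₁) ∙⟩ (cong (_⊠ dS) hopf-S′ ⟨∙ d) ⟩
    (M ⊠ id₁) ∙ ((M ∙ (S ⊠ id₁) ∙ d) ⊠ dS) ∙ d   ≡⟨ (M ⊠ id₁) ∙⟩ (expand ⟨∙ d) ⟩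
    (M ⊠ id₁) ∙ ((M ⊠ id₂) ∙ ((S ⊠ id₁) ⊠ dS) ∙ (d ⊠ id₁)) ∙ d
      ≡⟨ (M ⊠ id₁) ∙⟩ trans (∙-assoc _ _ _) ((M ⊠ id₂) ∙⟩ ∙-assoc _ _ _) ⟩
    (M ⊠ id₁) ∙ (M ⊠ id₂) ∙ ((S ⊠ id₁) ⊠ dS) ∙ (d ⊠ id₁) ∙ d
      ≡⟨ (M ⊠ id₁) ∙⟩ ((M ⊠ id₂) ∙⟩ (((S ⊠ id₁) ⊠ dS) ∙⟩ G.δ-coassocM)) ⟩
    (M ⊠ id₁) ∙ (M ⊠ id₂) ∙ ((S ⊠ id₁) ⊠ dS) ∙ (id₁ ⊠ d) ∙ d
      ≡⟨ sym (∙-assoc _ _ _) ⟩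
    ((M ⊠ id₁) ∙ (M ⊠ id₂)) ∙ ((S ⊠ id₁) ⊠ dS) ∙ (id₁ ⊠ d) ∙ d
      ≡⟨ cong₂ _∙_ R.μ-assoc-beside (⊠-assoc S id₁ dS ⟨∙ _) ⟩
    ((M ⊠ id₁) ∙ (id₁ ⊠ (M ⊠ id₁))) ∙ (S ⊠ (id₁ ⊠ dS)) ∙ (id₁ ⊠ d) ∙ d
      ≡⟨ trans (∙-assoc _ _ _) ((M ⊠ id₁) ∙⟩ sym (∙-assoc _ _ _)) ⟩
    (M ⊠ id₁) ∙ ((id₁ ⊠ (M ⊠ id₁)) ∙ (S ⊠ (id₁ ⊠ dS))) ∙ (id₁ ⊠ d) ∙ d
      ≡⟨ (M ⊠ id₁) ∙⟩ (trans (⊠-∙ id₁ (M ⊠ id₁) S (id₁ ⊠ dS)) (⊠≡ (∙-idl S) refl) ⟨∙ _) ⟩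
    (M ⊠ id₁) ∙ (S ⊠ Y) ∙ (id₁ ⊠ d) ∙ d          ≡⟨ (M ⊠ id₁) ∙⟩ sym (∙-assoc _ _ _) ⟩
    (M ⊠ id₁) ∙ ((S ⊠ Y) ∙ (id₁ ⊠ d)) ∙ d
      ≡⟨ (M ⊠ id₁) ∙⟩ (trans (⊠-∙ S Y id₁ d) (⊠≡ (∙-idr S) (trans (∙-assoc _ _ _) S-interaction)) ⟨∙ d) ⟩
    (M ⊠ id₁) ∙ (S ⊠ (U ⊠ S)) ∙ d                ≡⟨ sym (∙-assoc _ _ _) ⟩
    ((M ⊠ id₁) ∙ (S ⊠ (U ⊠ S))) ∙ d              ≡⟨ R.μ-unit-between S S ⟨∙ d ⟩
    (S ⊠ S) ∙ d                                  ∎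
    where
    dS = d ∙ S
    Y : Mor 2 2
    Y = (M ⊠ id₁) ∙ (id₁ ⊠ dS)
    expand : (M ∙ (S ⊠ id₁) ∙ d) ⊠ dS ≡ (M ⊠ id₂) ∙ ((S ⊠ id₁) ⊠ dS) ∙ (d ⊠ id₁)
    expand = begin
      (M ∙ (S ⊠ id₁) ∙ d) ⊠ dS                     ≡⟨ ⊠≡ refl (sym (trans (∙-idl _) (∙-idr _))) ⟩
      (M ∙ (S ⊠ id₁) ∙ d) ⊠ (id₂ ∙ dS ∙ id₁)       ≡⟨ ∙-⊠ M id₂ ((S ⊠ id₁) ∙ d) (dS ∙ id₁) ⟩
      (M ⊠ id₂) ∙ (((S ⊠ id₁) ∙ d) ⊠ (dS ∙ id₁))   ≡⟨ (M ⊠ id₂) ∙⟩ ∙-⊠ (S ⊠ id₁) dS d id₁ ⟩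
      (M ⊠ id₂) ∙ ((S ⊠ id₁) ⊠ dS) ∙ (d ⊠ id₁)     ∎

  -- s and S are mutually inverse: each slides one cup onto the other, and
  -- the snake equations cancel the remaining cap and cup.
  s-slides : (id₁ ⊠ s) ∙ cupᵍ ≡ cupʳ
  s-slides = transpose-slide (e ∙ m) cupʳ cupᵍ G.snakeʳ

  S-slides : (id₁ ⊠ S) ∙ cupʳ ≡ cupᵍ
  S-slides = transpose-slide (E ∙ M) cupᵍ cupʳ R.snakeʳ

  s∙S≡id : s ∙ S ≡ id₁
  s∙S≡id = trans (transpose-absorb (E ∙ M) s cupᵍ cupʳ s-slides) R.snakeˡ

  S∙s≡id : S ∙ s ≡ id₁
  S∙s≡id = trans (transpose-absorb (e ∙ m) S cupʳ cupᵍ S-slides) G.snakeˡ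

  s-comultiplicative : d ∙ s ≡ (s ⊠ s) ∙ d
  s-comultiplicative = begin
    d ∙ s                        ≡⟨ sym (∙-idl _) ⟩
    id₂ ∙ d ∙ s                  ≡⟨ sym ss∙SS≡id ⟨∙ (d ∙ s) ⟩
    ((s ⊠ s) ∙ (S ⊠ S)) ∙ d ∙ s  ≡⟨ trans (∙-assoc _ _ _) ((s ⊠ s) ∙⟩ sym (∙-assoc _ _ _)) ⟩
    (s ⊠ s) ∙ ((S ⊠ S) ∙ d) ∙ s  ≡⟨ (s ⊠ s) ∙⟩ (sym S-comultiplicative ⟨∙ s) ⟩
    (s ⊠ s) ∙ (d ∙ S) ∙ s        ≡⟨ (s ⊠ s) ∙⟩ ∙-assoc _ _ _ ⟩
    (s ⊠ s) ∙ d ∙ S ∙ s          ≡⟨ (s ⊠ s) ∙⟩ (d ∙⟩ S∙s≡id) ⟩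
    (s ⊠ s) ∙ d ∙ id₁            ≡⟨ (s ⊠ s) ∙⟩ ∙-idr d ⟩
    (s ⊠ s) ∙ d                  ∎
    where
    ss∙SS≡id : (s ⊠ s) ∙ (S ⊠ S) ≡ id₂
    ss∙SS≡id = trans (⊠-∙ s s S S) (trans (⊠≡ s∙S≡id s∙S≡id) ⊠-id)

  εᵍ∙s≡εᵍ : e ∙ s ≡ e
  εᵍ∙s≡εᵍ = begin
    e ∙ ((e ∙ m) ⊠ id₁) ∙ (id₁ ⊠ cupʳ)    ≡⟨ sym (∙-assoc _ _ _) ⟩
    (e ∙ ((e ∙ m) ⊠ id₁)) ∙ (id₁ ⊠ cupʳ)  ≡⟨ e-past-cap ⟨∙ (id₁ ⊠ cupʳ) ⟩
    ((e ∙ m) ∙ (id₂ ⊠ e)) ∙ (id₁ ⊠ cupʳ)  ≡⟨ ∙-assoc _ _ _ ⟩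
    (e ∙ m) ∙ (id₂ ⊠ e) ∙ (id₁ ⊠ cupʳ)    ≡⟨ (e ∙ m) ∙⟩ e-onto-cup ⟩
    (e ∙ m) ∙ (id₁ ⊠ u)                   ≡⟨ ∙-assoc _ _ _ ⟩
    e ∙ m ∙ (id₁ ⊠ u)                     ≡⟨ e ∙⟩ G.μ-unitʳM ⟩
    e ∙ id₁                               ≡⟨ ∙-idr e ⟩
    e                                     ∎
    where
    e-past-cap : e ∙ ((e ∙ m) ⊠ id₁) ≡ (e ∙ m) ∙ (id₂ ⊠ e)
    e-past-cap = begin
      e ∙ ((e ∙ m) ⊠ id₁)          ≡⟨ sym (⊠-unitˡ e) ⟨∙ ((e ∙ m) ⊠ id₁) ⟩
      (id₀ ⊠ e) ∙ ((e ∙ m) ⊠ id₁)  ≡⟨ ⊠-∙ id₀ e (e ∙ m) id₁ ⟩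
      (id₀ ∙ e ∙ m) ⊠ (e ∙ id₁)    ≡⟨ ⊠≡ (trans (∙-idl _) (sym (∙-idr _))) (trans (∙-idr e) (sym (∙-idl e))) ⟩
      ((e ∙ m) ∙ id₂) ⊠ (id₀ ∙ e)  ≡⟨ ∙-⊠ (e ∙ m) id₀ id₂ e ⟩
      ((e ∙ m) ⊠ id₀) ∙ (id₂ ⊠ e)  ≡⟨ ⊠-unitʳ (e ∙ m) ⟨∙ (id₂ ⊠ e) ⟩
      (e ∙ m) ∙ (id₂ ⊠ e)          ∎
    e-onto-cup : (id₂ ⊠ e) ∙ (id₁ ⊠ cupʳ) ≡ id₁ ⊠ u
    e-onto-cup = begin
      (id₂ ⊠ e) ∙ (id₁ ⊠ cupʳ)          ≡⟨ trans (⊠≡ (sym ⊠-id) refl) (⊠-assoc id₁ id₁ e) ⟨∙ (id₁ ⊠ cupʳ) ⟩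
      (id₁ ⊠ (id₁ ⊠ e)) ∙ (id₁ ⊠ cupʳ)  ≡⟨ ⊠-∙ id₁ (id₁ ⊠ e) id₁ cupʳ ⟩
      (id₁ ∙ id₁) ⊠ ((id₁ ⊠ e) ∙ cupʳ)  ≡⟨ ⊠≡ (∙-idl id₁) εᵍ-caps-cupʳ ⟩
      id₁ ⊠ u                           ∎

  -- The Hopf law for s: compose the Hopf law for S with s, using that s is
  -- a comonoid morphism inverse to S.
  hopf-lawM : M ∙ (id₁ ⊠ s) ∙ d ≡ U ∙ e
  hopf-lawM = sym (begin
    U ∙ e                        ≡⟨ U ∙⟩ sym εᵍ∙s≡εᵍ ⟩
    U ∙ e ∙ s                    ≡⟨ sym (∙-assoc _ _ _) ⟩
    (U ∙ e) ∙ s                  ≡⟨ hopf-S′ ⟨∙ s ⟩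
    (M ∙ (S ⊠ id₁) ∙ d) ∙ s      ≡⟨ trans (∙-assoc _ _ _) (M ∙⟩ ∙-assoc _ _ _) ⟩
    M ∙ (S ⊠ id₁) ∙ d ∙ s        ≡⟨ M ∙⟩ ((S ⊠ id₁) ∙⟩ s-comultiplicative) ⟩
    M ∙ (S ⊠ id₁) ∙ (s ⊠ s) ∙ d  ≡⟨ M ∙⟩ sym (∙-assoc _ _ _) ⟩
    M ∙ ((S ⊠ id₁) ∙ (s ⊠ s)) ∙ d ≡⟨ M ∙⟩ (trans (⊠-∙ S id₁ s s) (⊠≡ S∙s≡id (∙-idl s)) ⟨∙ d) ⟩
    M ∙ (id₁ ⊠ s) ∙ d            ∎)

  un-s≡antipode : un s ≡ antipode
  un-s≡antipode = ≅-unique s≅ antipode≅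
    where
    K : Hom (A ⊗₀ I) (I ⊗₀ A)
    K = ((εg ∘ μg) ⊗₁ id) ∘ α⁻¹ ∘ (id ⊗₁ (δr ∘ ηr))
    s≅ : un s ≅ K
    s≅ = ≅-trans (≅-∙ (≅-trans (≅-⊠ (≅-∙ ≅-refl ≅-refl) ≅-refl) (≅-sym (absorbʳ ≅-refl α⁻¹≅id)))
                      (≅-⊠ ≅-refl (≅-∙ ≅-refl ≅-refl)))
                 (≡⇒≅ (assoc _ _ _))
    antipode≅ : antipode ≅ K
    antipode≅ = absorbˡ λ≅id (≅-∘ ≅-refl (≅-∘ ≅-refl (absorbʳ ≅-refl ρ⁻¹≅id)))

  hopf-law : id + antipode ≡ zero
  hopf-law = ≅⇒≡ (≅-trans (≅-sym (≅-∙ ≅-refl (≅-∙ (≅-trans (un-⊠ id₁ s) (≅-⊗ ≅-refl (≡⇒≅ un-s≡antipode))) ≅-refl)))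
                 (≅-trans (≡⇒≅ (cong un hopf-lawM)) (≅-∙ ≅-refl ≅-refl)))

module Convolution {o ℓ} (𝒞 : StrictSymMonDaggerCat o ℓ) {A : StrictSymMonDaggerCat.Obj 𝒞}
                   (F : IFStructure 𝒞 A) where
  open StrictSymMonDaggerCat 𝒞
  open IFStructure F
  open ≡-Reasoning

  ∘-distribˡ-+ : ∀ {f} → f ∘ μr ≡ μr ∘ (f ⊗₁ f) → ∀ g h → f ∘ (g + h) ≡ (f ∘ g) + (f ∘ h)
  ∘-distribˡ-+ {f} pres-μr g h = begin
    f ∘ μr ∘ (g ⊗₁ h) ∘ δg          ≡⟨ sym (assoc _ _ _) ⟩
    (f ∘ μr) ∘ (g ⊗₁ h) ∘ δg        ≡⟨ cong (_∘ ((g ⊗₁ h) ∘ δg)) pres-μr ⟩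
    (μr ∘ (f ⊗₁ f)) ∘ (g ⊗₁ h) ∘ δg ≡⟨ assoc _ _ _ ⟩
    μr ∘ (f ⊗₁ f) ∘ (g ⊗₁ h) ∘ δg   ≡⟨ cong (μr ∘_) (sym (assoc _ _ _)) ⟩
    μr ∘ ((f ⊗₁ f) ∘ (g ⊗₁ h)) ∘ δg ≡⟨ cong (λ z → μr ∘ z ∘ δg) (sym (⊗-∘ _ _ _ _)) ⟩
    μr ∘ ((f ∘ g) ⊗₁ (f ∘ h)) ∘ δg  ∎

  ∘-distribʳ-+ : ∀ {f} → δg ∘ f ≡ (f ⊗₁ f) ∘ δg → ∀ g h → (g + h) ∘ f ≡ (g ∘ f) + (h ∘ f)
  ∘-distribʳ-+ {f} pres-δg g h = begin
    (μr ∘ (g ⊗₁ h) ∘ δg) ∘ f        ≡⟨ trans (assoc _ _ _) (cong (μr ∘_) (assoc _ _ _)) ⟩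
    μr ∘ (g ⊗₁ h) ∘ δg ∘ f          ≡⟨ cong (λ z → μr ∘ (g ⊗₁ h) ∘ z) pres-δg ⟩
    μr ∘ (g ⊗₁ h) ∘ (f ⊗₁ f) ∘ δg   ≡⟨ cong (μr ∘_) (sym (assoc _ _ _)) ⟩
    μr ∘ ((g ⊗₁ h) ∘ (f ⊗₁ f)) ∘ δg ≡⟨ cong (λ z → μr ∘ z ∘ δg) (sym (⊗-∘ _ _ _ _)) ⟩
    μr ∘ ((g ∘ f) ⊗₁ (h ∘ f)) ∘ δg  ∎

  ∘-zero : ∀ {f} → f ∘ ηr ≡ ηr → f ∘ zero ≡ zero
  ∘-zero {f} pres-ηr = trans (sym (assoc f ηr εg)) (cong (_∘ εg) pres-ηr)

-- The last part is
-- f + f ∘ s = f ∘ (id + s) = f ∘ 0 = 0, by the Hopf law.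
proposition4 : ∀ {o ℓ} (𝒞 : StrictSymMonDaggerCat o ℓ) →
    let open StrictSymMonDaggerCat 𝒞 in
    ∀ {A : Obj} (F : IFStructure 𝒞 A) →
    let open IFStructure F in
    ∀ (f : Hom A A) → IsBialgebraMorphism f →
    (∀ (g h : Hom A A) → f ∘ (g + h) ≡ (f ∘ g) + (f ∘ h))
    × (∀ (g h : Hom A A) → (g + h) ∘ f ≡ (g ∘ f) + (h ∘ f))
    × (f + (f ∘ antipode) ≡ zero)
proposition4 𝒞 F f bialgebra-morphism =
  ∘-distribˡ-+ pres-μr , ∘-distribʳ-+ pres-δg , additive-inverse
  where
  open StrictSymMonDaggerCat 𝒞
  open IFStructure F
  open IsBialgebraMorphism bialgebra-morphism
  open Convolution 𝒞 F
  open HopfLaw 𝒞 F using (hopf-law)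
  open ≡-Reasoning

  additive-inverse : f + (f ∘ antipode) ≡ zero
  additive-inverse = begin
    f + (f ∘ antipode)        ≡⟨ cong (_+ (f ∘ antipode)) (sym (identityʳ f)) ⟩
    (f ∘ id) + (f ∘ antipode) ≡⟨ sym (∘-distribˡ-+ pres-μr id antipode) ⟩
    f ∘ (id + antipode)       ≡⟨ cong (f ∘_) hopf-law ⟩
    f ∘ zero                  ≡⟨ ∘-zero pres-ηr ⟩
    zero                      ∎
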